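{- Let $m$ and $n$ be natural numbers with $m\leq n$, and let $K_{m,n}$ be the complete bipartite graph with parts of sizes $m$ and $n$. Then: (i) if $m$ and $n$ are both even, $\gamma'_s(K_{m,n})=\min(2m,n)$; (ii) if $m$ and $n$ are both odd, $\gamma'_s(K_{m,n})=\min(2m-1,n)$; (iii) if $m$ is even and $n$ is odd, $\gamma'_s(K_{m,n})=\min(3m,\max(2m,n+1))$; (iv) if $m$ is odd and $n$ is even, $\gamma'_s(K_{m,n})=\min(3m-1,\max(2m,n))$.
   Context: All graphs are finite, simple and undirected. For an edge $e=uv$, $N[e]$ denotes the set of edges of $G$ sharing at least one endpoint with $e$ (including $e$ itself). For a graph $G$ with at least one edge, a function $f:E(G)\to\{ -1,1\}$ is a signed edge domination function (SEDF) if $\sum_{e'\in N[e]}f(e')\geq 1$ for every $e\in E(G)$. The signed edge domination number is $\gamma'_s(G)=\min\{\sum_{e\in E(G)}f(e) : f \text{ is an SEDF of } G\}$. -}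

module Defs where

open import Data.Nat as ℕ using (ℕ; zero; suc)
open import Data.Integer as ℤ using (ℤ; +_; -_; _+_; _≤_)
open import Data.Fin using (Fin; zero; suc)
open import Data.Fin.Properties using () renaming (_≟_ to _≟ᶠ_)
open import Data.Product using (_×_; _,_; Σ)
open import Data.Sum using (_⊎_)
open import Data.Bool using (if_then_else_)
open import Data.Sign using (Sign) renaming (+ to plus; - to minus)
open import Relation.Nullary.Decidable using (⌊_⌋; _⊎-dec_)
open import Relation.Binary.PropositionalEquality using (_≡_)

ΣFin : (k : ℕ) → (Fin k → ℤ) → ℤ
ΣFin zero    g = + 0
ΣFin (suc k) g = g zero + ΣFin k (λ i → g (suc i))

-- The complete bipartite graph K_{m,n}: parts Fin m and Fin n; every
-- pair (i , j) is an edge, so the edge set is Fin m × Fin n.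
Edge : ℕ → ℕ → Set
Edge m n = Fin m × Fin n

ΣEdge : (m n : ℕ) → (Edge m n → ℤ) → ℤ
ΣEdge m n g = ΣFin m (λ i → ΣFin n (λ j → g (i , j)))

SharesEndpoint : {m n : ℕ} → Edge m n → Edge m n → Set
SharesEndpoint (i , j) (i' , j') = (i ≡ i') ⊎ (j ≡ j')

signVal : Sign → ℤ
signVal plus  = + 1
signVal minus = - (+ 1)

Labelling : ℕ → ℕ → Set
Labelling m n = Edge m n → Sign

closedNbhdSum : {m n : ℕ} → Labelling m n → Edge m n → ℤ
closedNbhdSum {m} {n} f (i , j) =
  ΣEdge m n (λ { (i' , j') →
    if ⌊ (i ≟ᶠ i') ⊎-dec (j ≟ᶠ j') ⌋ then signVal (f (i' , j')) else + 0 })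

weight : {m n : ℕ} → Labelling m n → ℤ
weight {m} {n} f = ΣEdge m n (λ e → signVal (f e))

IsSEDF : {m n : ℕ} → Labelling m n → Set
IsSEDF {m} {n} f = (e : Edge m n) → + 1 ≤ closedNbhdSum f e

SignedEdgeDominationNumber : (m n : ℕ) → ℤ → Set
SignedEdgeDominationNumber m n k =
  Σ (Labelling m n) (λ f → IsSEDF f × weight f ≡ k)
  × ((f : Labelling m n) → IsSEDF f → k ≤ weight f)

open import Data.Nat.Divisibility using (_∣_)
open import Relation.Nullary using (¬_)

Even : ℕ → Set
Even k = 2 ∣ k

Odd : ℕ → Set
Odd k = ¬ (2 ∣ k)

module Submission where

open import Defs

-- Write f(ij) = ±1 for the labels, r_i and c_j for the row and column sums
-- and W = Σ r_i = Σ c_j for the weight.  The closed neighbourhood of ij is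
-- row i together with column j, so f is an SEDF iff r_i + c_j − f(ij) ≥ 1.
--
-- The module CompleteBipartite proves this decomposition and then the lower
-- bounds: summing c_j ≥ k + f(ij) − r_i over j, one row of small sum forces
-- a large W, while if all rows are large then W ≥ m·min r_i; parity (r_i ≡ n,
-- c_j ≡ m, and neighbourhood sums are even when m + n is odd) sharpens both,
-- and the transpose gives the column versions.  It then assembles SEDFs from
-- blocks of columns with patterned top, bottom and (for odd m) extra rows,
-- each block accepted by a numerical check of its column sum against lower
-- bounds for the row sums, and gives seven such designs.

module CompleteBipartite where

  open import Data.Nat as ℕ using (ℕ; zero; suc; z≤n; s≤s; _∸_; _⊓_; _⊔_)
  import Data.Nat.Properties as ℕP
  open import Data.Nat.Divisibility using (divides)
  open import Data.Nat.Tactic.RingSolver using () renaming (solve-∀ to ℕ-solve)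
  open import Data.Integer as ℤ using (ℤ; +_; -_; -[1+_]; _+_; _-_; _*_; _≤_; +≤+; -≤+)
  import Data.Integer.Properties as ℤP
  open import Data.Integer.Tactic.RingSolver using (solve-∀)
  open import Algebra.Properties.CommutativeMonoid.Sum ℤP.+-0-commutativeMonoid
    using (sum; sum-cong-≗; ∑-distrib-+; ∑-comm)
  open import Data.Fin using (Fin; zero; suc; toℕ)
  open import Data.Fin.Properties using (all?; ¬∀⟶∃¬; toℕ<n) renaming (_≟_ to _≟ᶠ_)
  open import Data.Product using (_×_; _,_; Σ-syntax; ∃; proj₁; proj₂)
  open import Data.Sum using (_⊎_; inj₁; inj₂)
  open import Data.Bool using (Bool; true; false; if_then_else_; _∨_)
  open import Data.Sign using (Sign) renaming (+ to plus; - to minus)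
  open import Data.Empty using (⊥-elim)
  open import Data.List using (List; []; _∷_)
  open import Data.List.Membership.Propositional using (_∈_)
  open import Data.List.Relation.Unary.Any using (here; there)
  open import Data.List.Relation.Unary.All as All using (All; []; _∷_)
  open import Function using (_∘_)
  open import Relation.Nullary using (¬_; Dec; yes; no; does)
  open import Relation.Nullary.Decidable
    using (⌊_⌋; _⊎-dec_; isYes≗does; dec-true; dec-false; True; toWitness)
  open import Relation.Binary.PropositionalEquality

  -- ΣFin is the library's vector sum for the additive monoid of ℤ; the
  -- bridge lets us reuse the library's congruence, linearity and Fubini laws.
  ΣFin≡sum : ∀ k (g : Fin k → ℤ) → ΣFin k g ≡ sum g
  ΣFin≡sum zero    g = refl
  ΣFin≡sum (suc k) g = cong (λ s → g zero + s) (ΣFin≡sum k (λ i → g (suc i)))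

  ΣFin-cong : ∀ k {g h : Fin k → ℤ} → (∀ x → g x ≡ h x) → ΣFin k g ≡ ΣFin k h
  ΣFin-cong k {g} {h} g≗h =
    trans (ΣFin≡sum k g) (trans (sum-cong-≗ g≗h) (sym (ΣFin≡sum k h)))

  ΣFin-+ : ∀ k (g h : Fin k → ℤ) → ΣFin k (λ x → g x + h x) ≡ ΣFin k g + ΣFin k h
  ΣFin-+ k g h = begin
    ΣFin k (λ x → g x + h x)  ≡⟨ ΣFin≡sum k _ ⟩
    sum (λ x → g x + h x)     ≡⟨ ∑-distrib-+ g h ⟩
    sum g + sum h             ≡⟨ sym (cong₂ _+_ (ΣFin≡sum k g) (ΣFin≡sum k h)) ⟩
    ΣFin k g + ΣFin k h       ∎
    where open ≡-Reasoning

  ΣFin-neg : ∀ k (g : Fin k → ℤ) → ΣFin k (λ x → - g x) ≡ - ΣFin k g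
  ΣFin-neg zero    g = refl
  ΣFin-neg (suc k) g =
    trans (cong (λ s → - g zero + s) (ΣFin-neg k _)) (sym (ℤP.neg-distrib-+ (g zero) _))

  ΣFin-- : ∀ k (g h : Fin k → ℤ) → ΣFin k (λ x → g x - h x) ≡ ΣFin k g - ΣFin k h
  ΣFin-- k g h = trans (ΣFin-+ k g (λ x → - h x)) (cong (λ s → ΣFin k g + s) (ΣFin-neg k h))

  ΣFin-const : ∀ k (a : ℤ) → ΣFin k (λ _ → a) ≡ + k * a
  ΣFin-const zero    a = sym (ℤP.*-zeroˡ a)
  ΣFin-const (suc k) a = trans (cong (λ s → a + s) (ΣFin-const k a)) (step a (+ k))
    where step : ∀ a k → a + k * a ≡ (+ 1 + k) * a
          step = solve-∀

  ΣFin-swap : ∀ m n (g : Fin m → Fin n → ℤ) →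
    ΣFin m (λ i → ΣFin n (g i)) ≡ ΣFin n (λ j → ΣFin m (λ i → g i j))
  ΣFin-swap m n g = begin
    ΣFin m (λ i → ΣFin n (g i))          ≡⟨ ΣFin≡sum m _ ⟩
    sum (λ i → ΣFin n (g i))             ≡⟨ sum-cong-≗ (λ i → ΣFin≡sum n (g i)) ⟩
    sum (λ i → sum (g i))                ≡⟨ ∑-comm g ⟩
    sum (λ j → sum (λ i → g i j))        ≡⟨ sum-cong-≗ (λ j → sym (ΣFin≡sum m (λ i → g i j))) ⟩
    sum (λ j → ΣFin m (λ i → g i j))     ≡⟨ sym (ΣFin≡sum n _) ⟩
    ΣFin n (λ j → ΣFin m (λ i → g i j))  ∎
    where open ≡-Reasoning

  ΣFin-mono : ∀ k {g h : Fin k → ℤ} → (∀ x → g x ≤ h x) → ΣFin k g ≤ ΣFin k h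
  ΣFin-mono zero    g≤h = ℤP.≤-refl
  ΣFin-mono (suc k) g≤h = ℤP.+-mono-≤ (g≤h zero) (ΣFin-mono k (λ x → g≤h (suc x)))

  _if_ : ℤ → Bool → ℤ
  x if b = if b then x else + 0

  ΣFin-if : ∀ k (b : Bool) (g : Fin k → ℤ) → ΣFin k (λ x → g x if b) ≡ ΣFin k g if b
  ΣFin-if k true  g = refl
  ΣFin-if k false g = trans (ΣFin-const k (+ 0)) (ℤP.*-zeroʳ (+ k))

  ΣFin-δ : ∀ k (i : Fin k) (x : Fin k → ℤ) → ΣFin k (λ i' → x i' if does (i ≟ᶠ i')) ≡ x i
  ΣFin-δ (suc k) zero    x =
    trans (cong (λ s → x zero + s) (ΣFin-if k false (λ i' → x (suc i')))) (ℤP.+-identityʳ _)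
  ΣFin-δ (suc k) (suc i) x = trans (ℤP.+-identityˡ _) (ΣFin-δ k i (λ i' → x (suc i')))

  if-∨ : ∀ (a b : Bool) (x : ℤ) → x if (a ∨ b) ≡ x if a + x if b - (x if b) if a
  if-∨ true  true  x = sym (collapse x)
    where collapse : ∀ x → x + x - x ≡ x
          collapse = solve-∀
  if-∨ true  false x = sym (collapse x)
    where collapse : ∀ x → x + + 0 - + 0 ≡ x
          collapse = solve-∀
  if-∨ false true  x = sym (collapse x)
    where collapse : ∀ x → + 0 + x - + 0 ≡ x
          collapse = solve-∀
  if-∨ false false x = refl

  module _ {m n : ℕ} (f : Labelling m n) where

    sgn : Fin m → Fin n → ℤ
    sgn i j = signVal (f (i , j))

    rowSum : Fin m → ℤ
    rowSum i = ΣFin n (sgn i)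

    colSum : Fin n → ℤ
    colSum j = ΣFin m (λ i → sgn i j)

    weight-by-columns : weight f ≡ ΣFin n colSum
    weight-by-columns = ΣFin-swap m n sgn

  -- The closed neighbourhood of (i , j) is row i together with column j,
  -- and the edge itself lies in both: N[ij] sums to r_i + c_j − f(ij).
  nbhd-decomposition : ∀ {m n} (f : Labelling m n) i j →
    closedNbhdSum f (i , j) ≡ rowSum f i + colSum f j - sgn f i j
  nbhd-decomposition {m} {n} f i j = begin
      closedNbhdSum f (i , j)
    ≡⟨ ΣFin-cong m (λ i' → ΣFin-cong n (λ j' → split i' j')) ⟩
      ΣFin m (λ i' → ΣFin n (λ j' → inRow i' j' + inCol i' j' - atEdge i' j'))
    ≡⟨ ΣFin-cong m (λ i' → trans (ΣFin-- n _ _) (cong (_- ΣFin n (atEdge i')) (ΣFin-+ n _ _))) ⟩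
      ΣFin m (λ i' → ΣFin n (inRow i') + ΣFin n (inCol i') - ΣFin n (atEdge i'))
    ≡⟨ trans (ΣFin-- m _ _) (cong (_- ΣFin m (λ i' → ΣFin n (atEdge i'))) (ΣFin-+ m _ _)) ⟩
      ΣFin m (λ i' → ΣFin n (inRow i')) + ΣFin m (λ i' → ΣFin n (inCol i'))
        - ΣFin m (λ i' → ΣFin n (atEdge i'))
    ≡⟨ cong₂ _-_ (cong₂ _+_ rowPart colPart) edgePart ⟩
      rowSum f i + colSum f j - sgn f i j
    ∎
    where
    open ≡-Reasoning
    sameRow : Fin m → Bool
    sameRow i' = does (i ≟ᶠ i')
    sameCol : Fin n → Bool
    sameCol j' = does (j ≟ᶠ j')
    inRow inCol atEdge : Fin m → Fin n → ℤ
    inRow  i' j' = sgn f i' j' if sameRow i'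
    inCol  i' j' = sgn f i' j' if sameCol j'
    atEdge i' j' = (sgn f i' j' if sameCol j') if sameRow i'
    split : ∀ i' j' → sgn f i' j' if ⌊ (i ≟ᶠ i') ⊎-dec (j ≟ᶠ j') ⌋
                      ≡ inRow i' j' + inCol i' j' - atEdge i' j'
    split i' j' = trans (cong (sgn f i' j' if_) (isYes≗does ((i ≟ᶠ i') ⊎-dec (j ≟ᶠ j'))))
                        (if-∨ (sameRow i') (sameCol j') (sgn f i' j'))
    rowPart : ΣFin m (λ i' → ΣFin n (inRow i')) ≡ rowSum f i
    rowPart = trans (ΣFin-cong m (λ i' → ΣFin-if n (sameRow i') (sgn f i')))
                    (ΣFin-δ m i (rowSum f))
    colPart : ΣFin m (λ i' → ΣFin n (inCol i')) ≡ colSum f j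
    colPart = ΣFin-cong m (λ i' → ΣFin-δ n j (sgn f i'))
    edgePart : ΣFin m (λ i' → ΣFin n (atEdge i')) ≡ sgn f i j
    edgePart = trans (ΣFin-cong m (λ i' → ΣFin-if n (sameRow i') (inCol i')))
                     (trans (ΣFin-δ m i (λ i' → ΣFin n (inCol i'))) (ΣFin-δ n j (sgn f i)))

  -- Exchanging the two parts of K_{m,n}.  Row sums of the transpose are
  -- column sums of f (definitionally), weight and the SEDF property survive.
  transpose : ∀ {m n} → Labelling m n → Labelling n m
  transpose f (j , i) = f (i , j)

  weight-transpose : ∀ {m n} (f : Labelling m n) → weight (transpose f) ≡ weight f
  weight-transpose f = sym (weight-by-columns f)

  transpose-SEDF : ∀ {m n} (f : Labelling m n) → IsSEDF f → IsSEDF (transpose f)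
  transpose-SEDF f sedf (j , i) = subst (+ 1 ≤_) same (sedf (i , j))
    where
    swap : ∀ r c v → r + c - v ≡ c + r - v
    swap = solve-∀
    same : closedNbhdSum f (i , j) ≡ closedNbhdSum (transpose f) (j , i)
    same = trans (nbhd-decomposition f i j)
                 (trans (swap (rowSum f i) (colSum f j) (sgn f i j)) (sym (nbhd-decomposition (transpose f) j i)))

  -- Parity in ℤ: x ≡₂ y when x − y is even, witnessed by half the difference.
  -- (A record, so that both sides can be inferred from a proof.)
  infix 4 _≡₂_
  record _≡₂_ (x y : ℤ) : Set where
    constructor half
    field
      halfDiff : ℤ
      diff     : x ≡ y + (halfDiff + halfDiff)

  ≡₂-refl : ∀ x → x ≡₂ x
  ≡₂-refl x = half (+ 0) (sym (ℤP.+-identityʳ x))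

  ≡₂-trans : ∀ {x y w} → x ≡₂ y → y ≡₂ w → x ≡₂ w
  ≡₂-trans {w = w} (half a refl) (half b refl) = half (a + b) (regroup w a b)
    where regroup : ∀ w a b → w + (b + b) + (a + a) ≡ w + ((a + b) + (a + b))
          regroup = solve-∀

  ≡₂-+ : ∀ {x y a b} → x ≡₂ a → y ≡₂ b → x + y ≡₂ a + b
  ≡₂-+ {a = a} {b} (half u refl) (half v refl) = half (u + v) (regroup a b u v)
    where regroup : ∀ a b u v → a + (u + u) + (b + (v + v)) ≡ a + b + ((u + v) + (u + v))
          regroup = solve-∀

  ≡₂-- : ∀ {x y a b} → x ≡₂ a → y ≡₂ b → x - y ≡₂ a - b
  ≡₂-- {a = a} {b} (half u refl) (half v refl) = half (u - v) (regroup a b u v)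
    where regroup : ∀ a b u v → a + (u + u) - (b + (v + v)) ≡ a - b + ((u - v) + (u - v))
          regroup = solve-∀

  ≡₂-step : ∀ a → a ≡₂ a + + 2
  ≡₂-step a = half (- + 1) (back a)
    where back : ∀ a → a ≡ a + + 2 + (- + 1 + - + 1)
          back = solve-∀

  ≡₂-stepBack : ∀ a → a + + 2 ≡₂ a
  ≡₂-stepBack a = half (+ 1) (forward a)
    where forward : ∀ a → a + + 2 ≡ a + (+ 1 + + 1)
          forward = solve-∀

  signVal-parity : ∀ s → signVal s ≡₂ + 1
  signVal-parity plus  = half (+ 0) refl
  signVal-parity minus = half (- + 1) refl

  signSum-parity : ∀ k (s : Fin k → Sign) → ΣFin k (λ x → signVal (s x)) ≡₂ + k
  signSum-parity zero    s = half (+ 0) refl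
  signSum-parity (suc k) s = ≡₂-+ (signVal-parity (s zero)) (signSum-parity k (λ x → s (suc x)))

  halve : ∀ n → Σ[ q ∈ ℕ ] (n ≡ q ℕ.+ q ⊎ n ≡ suc (q ℕ.+ q))
  halve zero = 0 , inj₁ refl
  halve (suc n) with halve n
  ... | q , inj₁ e = q , inj₂ (cong suc e)
  ... | q , inj₂ e = suc q , inj₁ (cong suc (trans e (sym (ℕP.+-suc q q))))

  even-half : ∀ {n} → Even n → Σ[ q ∈ ℕ ] n ≡ q ℕ.+ q
  even-half {n} (divides q n≡q*2) = q , trans n≡q*2 (double q)
    where double : ∀ q → q ℕ.* 2 ≡ q ℕ.+ q
          double = ℕ-solve

  odd-half : ∀ {n} → Odd n → Σ[ q ∈ ℕ ] n ≡ suc (q ℕ.+ q)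
  odd-half {n} odd with halve n
  ... | q , inj₂ e = q , e
  ... | q , inj₁ e = ⊥-elim (odd (divides q (trans e (double q))))
    where double : ∀ q → q ℕ.+ q ≡ q ℕ.* 2
          double = ℕ-solve

  even-parity : ∀ {n} → Even n → + n ≡₂ + 0
  even-parity ev with even-half ev
  ... | q , refl = half (+ q) (ℤP.pos-+ q q)

  odd-parity : ∀ {n} → Odd n → + n ≡₂ + 1
  odd-parity od with odd-half od
  ... | q , refl = half (+ q) (cong (λ s → + 1 + s) (ℤP.pos-+ q q))

  ≡₂-≥ : ∀ {x a} → x ≡₂ a → a ≤ x + + 1 → a ≤ x
  ≡₂-≥ {x} {a} (half z refl) a≤x+1 = atLeast z (subst (+ 0 ≤_) (shift a z) (ℤP.i≤j⇒0≤j-i a≤x+1))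
    where
    shift : ∀ a z → a + (z + z) + + 1 - a ≡ z + z + + 1
    shift = solve-∀
    atLeast : ∀ z → + 0 ≤ z + z + + 1 → a ≤ a + (z + z)
    atLeast (+ k)     _  = ℤP.i≤i+j a (+ k + + k)
    atLeast -[1+ k ] ()

  ≡₂-≤ : ∀ {x a} → x ≡₂ a → x ≤ a + + 1 → x ≤ a
  ≡₂-≤ {x} {a} (half z x≡) x≤a+1 =
    ℤP.neg-cancel-≤ (≡₂-≥ (half (- z) negated)
                          (subst (_≤ - x + + 1) (flip a) (ℤP.+-monoˡ-≤ (+ 1) (ℤP.neg-mono-≤ x≤a+1))))
    where
    negated : - x ≡ - a + (- z + - z)
    negated = trans (cong -_ x≡) (neg a z)
      where neg : ∀ a z → - (a + (z + z)) ≡ - a + (- z + - z)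
            neg = solve-∀
    flip : ∀ a → - (a + + 1) + + 1 ≡ - a
    flip = solve-∀

  allOrCounterexample : ∀ {k} {P : Fin k → Set} → (∀ x → Dec (P x)) → (∀ x → P x) ⊎ ∃ λ x → ¬ P x
  allOrCounterexample {k} {P} P? with all? P?
  ... | yes everywhere = inj₁ everywhere
  ... | no  notEverywhere = inj₂ (¬∀⟶∃¬ k P P? notEverywhere)

  below : ∀ {a x} → ¬ (a ≤ x) → x ≤ ℤ.pred a
  below a≰x = ℤP.i<j⇒i≤pred[j] (ℤP.≰⇒> a≰x)

  isolate : ∀ {k r c v} → k ≤ r + c - v → k + v - r ≤ c
  isolate {k} {r} {c} {v} k≤ = subst₂ _≤_ (left k r v) (right r c v) (ℤP.+-monoˡ-≤ (v - r) k≤)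
    where
    left : ∀ k r v → k + (v - r) ≡ k + v - r
    left = solve-∀
    right : ∀ r c v → r + c - v + (v - r) ≡ c
    right = solve-∀

  antitone : ∀ n' c {r ρ} → r ≤ ρ → c + ρ - + suc n' * ρ ≤ c + r - + suc n' * r
  antitone n' c {r} {ρ} r≤ρ =
    subst₂ _≤_ (form c (+ n') ρ) (form c (+ n') r)
           (ℤP.+-monoʳ-≤ c (ℤP.neg-mono-≤ (ℤP.*-monoˡ-≤-nonNeg (+ n') r≤ρ)))
    where form : ∀ c n x → c + - (n * x) ≡ c + x - (+ 1 + n) * x
          form = solve-∀

  pos-∸ : ∀ a b → b ℕ.≤ a → + (a ∸ b) ≡ + a - + b
  pos-∸ a b b≤a = trans (sym (ℤP.⊖-≥ b≤a)) (sym (ℤP.m-n≡m⊖n a b))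

  ⊓-bound : ∀ a b {w} → + a ≤ w ⊎ + b ≤ w → + (a ⊓ b) ≤ w
  ⊓-bound a b (inj₁ a≤w) = ℤP.≤-trans (+≤+ (ℕP.m⊓n≤m a b)) a≤w
  ⊓-bound a b (inj₂ b≤w) = ℤP.≤-trans (+≤+ (ℕP.m⊓n≤n a b)) b≤w

  ⊔-bound : ∀ a b {w} → + a ≤ w → + b ≤ w → + (a ⊔ b) ≤ w
  ⊔-bound a b {w} a≤w b≤w with ℕP.⊔-sel a b
  ... | inj₁ a⊔b≡a = subst (λ x → + x ≤ w) (sym a⊔b≡a) a≤w
  ... | inj₂ a⊔b≡b = subst (λ x → + x ≤ w) (sym a⊔b≡b) b≤w

  -- Facts valid for every SEDF f of K_{m,n}, phrased for rows; applied to
  -- the transpose of f they give the same facts for columns.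
  module SEDFBounds {m n : ℕ} (f : Labelling m n) (sedf : IsSEDF f) where

    nbhd : Fin m → Fin n → ℤ
    nbhd i j = rowSum f i + colSum f j - sgn f i j

    nbhd≥1 : ∀ i j → + 1 ≤ nbhd i j
    nbhd≥1 i j = subst (+ 1 ≤_) (nbhd-decomposition f i j) (sedf (i , j))

    allRows : ∀ a → (∀ i → a ≤ rowSum f i) → + m * a ≤ weight f
    allRows a a≤r = subst (_≤ weight f) (ΣFin-const m a) (ΣFin-mono m a≤r)

    -- Summing  c_j ≥ k + f(ij) − r_i  over all columns j.
    rowBound : ∀ k i → (∀ j → k ≤ nbhd i j) → + n * k + rowSum f i - + n * rowSum f i ≤ weight f
    rowBound k i k≤nbhd = begin
      + n * k + r - + n * r             ≡⟨ sym columnTotal ⟩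
      ΣFin n (λ j → k + sgn f i j - r)  ≤⟨ ΣFin-mono n (λ j → isolate (k≤nbhd j)) ⟩
      ΣFin n (colSum f)                 ≡⟨ sym (weight-by-columns f) ⟩
      weight f                          ∎
      where
      open ℤP.≤-Reasoning
      r = rowSum f i
      columnTotal : ΣFin n (λ j → k + sgn f i j - r) ≡ + n * k + r - + n * r
      columnTotal = trans (ΣFin-- n (λ j → k + sgn f i j) (λ _ → r))
                          (cong₂ _-_ (trans (ΣFin-+ n (λ _ → k) (sgn f i)) (cong (_+ r) (ΣFin-const n k)))
                                     (ΣFin-const n r))

    rowBound≤ : ∀ k i ρ → 1 ℕ.≤ n → (∀ j → k ≤ nbhd i j) → rowSum f i ≤ ρ →
                + n * k + ρ - + n * ρ ≤ weight f
    rowBound≤ k i ρ (s≤s {n = n'} _) k≤nbhd r≤ρ =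
      ℤP.≤-trans (antitone n' (+ suc n' * k) r≤ρ) (rowBound k i k≤nbhd)

    rowParity : ∀ i → rowSum f i ≡₂ + n
    rowParity i = signSum-parity n (λ j → f (i , j))

    nbhdParity : ∀ i j → nbhd i j ≡₂ + n + + m - + 1
    nbhdParity i j = ≡₂-- (≡₂-+ (rowParity i) (signSum-parity m (λ i' → f (i' , j))))
                          (signVal-parity (f (i , j)))

    -- If n + m is odd, every neighbourhood sum is even, hence at least 2.
    nbhd≥2 : + n + + m ≡₂ + 1 → ∀ i j → + 2 ≤ nbhd i j
    nbhd≥2 oddSum i j =
      ≡₂-≥ (≡₂-trans (≡₂-trans (nbhdParity i j) (≡₂-- oddSum (≡₂-refl (+ 1)))) (≡₂-step (+ 0)))
           (ℤP.+-monoˡ-≤ (+ 1) (nbhd≥1 i j))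

    evenRow : + n ≡₂ + 0 → ∀ i → + 1 ≤ rowSum f i → + 2 ≤ rowSum f i
    evenRow evenN i 1≤r =
      ≡₂-≥ (≡₂-trans (≡₂-trans (rowParity i) evenN) (≡₂-step (+ 0))) (ℤP.+-monoˡ-≤ (+ 1) 1≤r)

    oddRow : + n ≡₂ + 1 → ∀ i → + 2 ≤ rowSum f i → + 3 ≤ rowSum f i
    oddRow oddN i 2≤r =
      ≡₂-≥ (≡₂-trans (≡₂-trans (rowParity i) oddN) (≡₂-step (+ 1))) (ℤP.+-monoˡ-≤ (+ 1) 2≤r)

    oddRow≤ : + n ≡₂ + 1 → ∀ i → rowSum f i ≤ + 0 → rowSum f i ≤ - + 1
    oddRow≤ oddN i r≤0 = ≡₂-≤ (≡₂-trans (≡₂-trans (rowParity i) oddN) (≡₂-stepBack (- + 1))) r≤0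

  module CaseBounds {m n : ℕ} (f : Labelling m n) (sedf : IsSEDF f)
                    (m≥1 : 1 ℕ.≤ m) (m≤n : m ℕ.≤ n) where

    open SEDFBounds f sedf
    module Col = SEDFBounds (transpose f) (transpose-SEDF f sedf)
    open ℤP.≤-Reasoning

    W : ℤ
    W = weight f

    n≥1 : 1 ℕ.≤ n
    n≥1 = ℕP.≤-trans m≥1 m≤n

    allCols : ∀ a → (∀ j → a ≤ colSum f j) → + n * a ≤ W
    allCols a a≤c = subst (+ n * a ≤_) (weight-transpose f) (Col.allRows a a≤c)

    colBound≤ : ∀ k j ρ → (∀ i → k ≤ Col.nbhd j i) → colSum f j ≤ ρ → + m * k + ρ - + m * ρ ≤ W
    colBound≤ k j ρ k≤nbhd c≤ρ =
      subst (+ m * k + ρ - + m * ρ ≤_) (weight-transpose f) (Col.rowBound≤ k j ρ m≥1 k≤nbhd c≤ρ)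

    2m≤2n : + (2 ℕ.* m) ≤ + n * + 2
    2m≤2n = begin
      + (2 ℕ.* m) ≡⟨ ℤP.pos-* 2 m ⟩
      + 2 * + m   ≤⟨ ℤP.*-monoˡ-≤-nonNeg (+ 2) (+≤+ m≤n) ⟩
      + 2 * + n   ≡⟨ ℤP.*-comm (+ 2) (+ n) ⟩
      + n * + 2   ∎

    lowRow : ∀ i → rowSum f i ≤ + 0 → + n ≤ W
    lowRow i r≤0 = begin
      + n                               ≡⟨ form (+ n) ⟩
      + n * + 1 + + 0 - + n * + 0       ≤⟨ rowBound≤ (+ 1) i (+ 0) n≥1 (nbhd≥1 i) r≤0 ⟩
      W                                 ∎
      where form : ∀ n → n ≡ n * + 1 + + 0 - n * + 0
            form = solve-∀

    bound-i : Even n → + (2 ℕ.* m ⊓ n) ≤ W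
    bound-i evenN with allOrCounterexample (λ i → + 1 ℤP.≤? rowSum f i)
    ... | inj₁ positive = ⊓-bound (2 ℕ.* m) n (inj₁ (begin
      + (2 ℕ.* m) ≡⟨ trans (ℤP.pos-* 2 m) (ℤP.*-comm (+ 2) (+ m)) ⟩
      + m * + 2   ≤⟨ allRows (+ 2) (λ i → evenRow (even-parity evenN) i (positive i)) ⟩
      W           ∎))
    ... | inj₂ (i , nonPositive) = ⊓-bound (2 ℕ.* m) n (inj₂ (lowRow i (below nonPositive)))

    bound-ii : Odd m → + ((2 ℕ.* m ∸ 1) ⊓ n) ≤ W
    bound-ii oddM with allOrCounterexample (λ j → + 1 ℤP.≤? colSum f j)
    ... | inj₁ positive = ⊓-bound (2 ℕ.* m ∸ 1) n (inj₂ (begin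
      + n        ≡⟨ sym (ℤP.*-identityʳ (+ n)) ⟩
      + n * + 1  ≤⟨ allCols (+ 1) positive ⟩
      W          ∎))
    ... | inj₂ (j , nonPositive) = ⊓-bound (2 ℕ.* m ∸ 1) n (inj₁ (begin
      + (2 ℕ.* m ∸ 1)                    ≡⟨ pos-∸ (2 ℕ.* m) 1 (ℕP.≤-trans m≥1 (ℕP.m≤n*m m 2)) ⟩
      + (2 ℕ.* m) - + 1                  ≡⟨ cong (_- + 1) (ℤP.pos-* 2 m) ⟩
      + 2 * + m - + 1                    ≡⟨ form (+ m) ⟩
      + m * + 1 + - + 1 - + m * - + 1    ≤⟨ colBound≤ (+ 1) j (- + 1) (Col.nbhd≥1 j)
                                              (Col.oddRow≤ (odd-parity oddM) j (below nonPositive)) ⟩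
      W                                  ∎))
      where form : ∀ m → + 2 * m - + 1 ≡ m * + 1 + - + 1 - m * - + 1
            form = solve-∀

    bound-iii : Even m → Odd n → + (3 ℕ.* m ⊓ (2 ℕ.* m ⊔ (n ℕ.+ 1))) ≤ W
    bound-iii evenM oddN with allOrCounterexample (λ i → + 2 ℤP.≤? rowSum f i)
    ... | inj₁ large = ⊓-bound (3 ℕ.* m) _ (inj₁ (begin
      + (3 ℕ.* m) ≡⟨ trans (ℤP.pos-* 3 m) (ℤP.*-comm (+ 3) (+ m)) ⟩
      + m * + 3   ≤⟨ allRows (+ 3) (λ i → oddRow (odd-parity oddN) i (large i)) ⟩
      W           ∎))
    ... | inj₂ (i , small) = ⊓-bound (3 ℕ.* m) _ (inj₂ (⊔-bound (2 ℕ.* m) (n ℕ.+ 1) 2m≤W n+1≤W))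
      where
      n+1≤W : + (n ℕ.+ 1) ≤ W
      n+1≤W = begin
        + (n ℕ.+ 1)                  ≡⟨ trans (ℤP.pos-+ n 1) (form (+ n)) ⟩
        + n * + 2 + + 1 - + n * + 1  ≤⟨ rowBound≤ (+ 2) i (+ 1) n≥1
                                          (nbhd≥2 (≡₂-+ (odd-parity oddN) (even-parity evenM)) i)
                                          (below small) ⟩
        W                            ∎
        where form : ∀ n → n + + 1 ≡ n * + 2 + + 1 - n * + 1
              form = solve-∀
      2m≤W : + (2 ℕ.* m) ≤ W
      2m≤W with allOrCounterexample (λ j → + 1 ℤP.≤? colSum f j)
      ... | inj₁ positive = ℤP.≤-trans 2m≤2n
              (allCols (+ 2) (λ j → Col.evenRow (even-parity evenM) j (positive j)))
      ... | inj₂ (j , nonPositive) = begin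
        + (2 ℕ.* m)                  ≡⟨ trans (ℤP.pos-* 2 m) (form (+ m)) ⟩
        + m * + 2 + + 0 - + m * + 0  ≤⟨ colBound≤ (+ 2) j (+ 0)
                                          (Col.nbhd≥2 (≡₂-+ (even-parity evenM) (odd-parity oddN)) j)
                                          (below nonPositive) ⟩
        W                            ∎
        where form : ∀ m → + 2 * m ≡ m * + 2 + + 0 - m * + 0
              form = solve-∀

    bound-iv : Odd m → Even n → + ((3 ℕ.* m ∸ 1) ⊓ (2 ℕ.* m ⊔ n)) ≤ W
    bound-iv oddM evenN with allOrCounterexample (λ i → + 1 ℤP.≤? rowSum f i)
    ... | inj₂ (i , nonPositive) =
      ⊓-bound _ _ (inj₂ (⊔-bound (2 ℕ.* m) n (ℤP.≤-trans 2m≤2n 2n≤W) (ℤP.≤-trans n≤2n 2n≤W)))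
      where
      2n≤W : + n * + 2 ≤ W
      2n≤W = begin
        + n * + 2                    ≡⟨ form (+ n) ⟩
        + n * + 2 + + 0 - + n * + 0  ≤⟨ rowBound≤ (+ 2) i (+ 0) n≥1
                                          (nbhd≥2 (≡₂-+ (even-parity evenN) (odd-parity oddM)) i)
                                          (below nonPositive) ⟩
        W                            ∎
        where form : ∀ n → n * + 2 ≡ n * + 2 + + 0 - n * + 0
              form = solve-∀
      n≤2n : + n ≤ + n * + 2
      n≤2n = begin
        + n        ≡⟨ sym (ℤP.*-identityˡ (+ n)) ⟩
        + 1 * + n  ≤⟨ ℤP.*-monoʳ-≤-nonNeg (+ n) {+ 1} {+ 2} (+≤+ (s≤s z≤n)) ⟩
        + 2 * + n  ≡⟨ ℤP.*-comm (+ 2) (+ n) ⟩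
        + n * + 2  ∎
    ... | inj₁ positive with allOrCounterexample (λ j → + 1 ℤP.≤? colSum f j)
    ...   | inj₁ colPositive = ⊓-bound _ _ (inj₂ (⊔-bound (2 ℕ.* m) n 2m≤W n≤W))
      where
      2m≤W : + (2 ℕ.* m) ≤ W
      2m≤W = begin
        + (2 ℕ.* m) ≡⟨ trans (ℤP.pos-* 2 m) (ℤP.*-comm (+ 2) (+ m)) ⟩
        + m * + 2   ≤⟨ allRows (+ 2) (λ i → evenRow (even-parity evenN) i (positive i)) ⟩
        W           ∎
      n≤W : + n ≤ W
      n≤W = subst (_≤ W) (ℤP.*-identityʳ (+ n)) (allCols (+ 1) colPositive)
    ...   | inj₂ (j , nonPositive) = ⊓-bound _ _ (inj₁ (begin
      + (3 ℕ.* m ∸ 1)                    ≡⟨ pos-∸ (3 ℕ.* m) 1 (ℕP.≤-trans m≥1 (ℕP.m≤n*m m 3)) ⟩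
      + (3 ℕ.* m) - + 1                  ≡⟨ cong (_- + 1) (ℤP.pos-* 3 m) ⟩
      + 3 * + m - + 1                    ≡⟨ form (+ m) ⟩
      + m * + 2 + - + 1 - + m * - + 1    ≤⟨ colBound≤ (+ 2) j (- + 1)
                                              (Col.nbhd≥2 (≡₂-+ (odd-parity oddM) (even-parity evenN)) j)
                                              (Col.oddRow≤ (odd-parity oddM) j (below nonPositive)) ⟩
      W                                  ∎))
      where form : ∀ m → + 3 * m - + 1 ≡ m * + 2 + - + 1 - m * - + 1
            form = solve-∀

  HasSEDF : ℕ → ℕ → ℤ → Set
  HasSEDF m n w = Σ[ f ∈ Labelling m n ] (IsSEDF f × weight f ≡ w)

  HasSEDF-cast : ∀ {m n w m' n' w'} → m ≡ m' → n ≡ n' → w ≡ w' → HasSEDF m' n' w' → HasSEDF m n w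
  HasSEDF-cast refl refl refl has = has

  toSign : Bool → Sign
  toSign true  = plus
  toSign false = minus

  signOf : Bool → ℤ
  signOf b = signVal (toSign b)

  signOf≤1 : ∀ b → signOf b ≤ + 1
  signOf≤1 true  = ℤP.≤-refl
  signOf≤1 false = -≤+

  -1≤signOf : ∀ b → - + 1 ≤ signOf b
  -1≤signOf true  = -≤+
  -1≤signOf false = ℤP.≤-refl

  excess : ∀ {a b} → a ℕ.≤ b → Σ[ r ∈ ℕ ] b ≡ a ℕ.+ r
  excess {a} {b} a≤b = b ∸ a , sym (ℕP.m+[n∸m]≡n a≤b)

  Σℕ : ℕ → (ℕ → ℤ) → ℤ
  Σℕ zero    g = + 0
  Σℕ (suc n) g = g 0 + Σℕ n (λ k → g (suc k))

  ΣFin-toℕ : ∀ n (g : ℕ → ℤ) → ΣFin n (λ j → g (toℕ j)) ≡ Σℕ n g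
  ΣFin-toℕ zero    g = refl
  ΣFin-toℕ (suc n) g = cong (λ s → g 0 + s) (ΣFin-toℕ n (λ k → g (suc k)))

  Σℕ-cong : ∀ n {g h : ℕ → ℤ} → (∀ k → k ℕ.< n → g k ≡ h k) → Σℕ n g ≡ Σℕ n h
  Σℕ-cong zero    g≗h = refl
  Σℕ-cong (suc n) g≗h = cong₂ _+_ (g≗h 0 (s≤s z≤n)) (Σℕ-cong n (λ k k< → g≗h (suc k) (s≤s k<)))

  Σℕ-split : ∀ a b (g : ℕ → ℤ) → Σℕ (a ℕ.+ b) g ≡ Σℕ a g + Σℕ b (λ k → g (a ℕ.+ k))
  Σℕ-split zero    b g = sym (ℤP.+-identityˡ _)
  Σℕ-split (suc a) b g =
    trans (cong (λ s → g 0 + s) (Σℕ-split a b (λ k → g (suc k)))) (sym (ℤP.+-assoc (g 0) _ _))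

  Σℕ-const : ∀ n (c : ℤ) → Σℕ n (λ _ → c) ≡ + n * c
  Σℕ-const zero    c = sym (ℤP.*-zeroˡ c)
  Σℕ-const (suc n) c = trans (cong (λ s → c + s) (Σℕ-const n c)) (step c (+ n))
    where step : ∀ c n → c + n * c ≡ (+ 1 + n) * c
          step = solve-∀

  Σℕ-constOn : ∀ n {g : ℕ → ℤ} c → (∀ k → k ℕ.< n → g k ≡ c) → Σℕ n g ≡ + n * c
  Σℕ-constOn n c g≡c = trans (Σℕ-cong n g≡c) (Σℕ-const n c)

  Σ-allPlus : ∀ n {b : ℕ → Bool} → (∀ k → k ℕ.< n → b k ≡ true) → Σℕ n (λ k → signOf (b k)) ≡ + n
  Σ-allPlus n b≡ = trans (Σℕ-constOn n (+ 1) (λ k k< → cong signOf (b≡ k k<))) (ℤP.*-identityʳ (+ n))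

  Σ-allMinus : ∀ n {b : ℕ → Bool} → (∀ k → k ℕ.< n → b k ≡ false) → Σℕ n (λ k → signOf (b k)) ≡ - + n
  Σ-allMinus n b≡ = trans (Σℕ-constOn n (- + 1) (λ k k< → cong signOf (b≡ k k<))) (minusOnes (+ n))
    where minusOnes : ∀ n → n * - + 1 ≡ - n
          minusOnes = solve-∀

  Σ-atLeast : ∀ n (b : ℕ → Bool) → - + n ≤ Σℕ n (λ k → signOf (b k))
  Σ-atLeast zero    b = ℤP.≤-refl
  Σ-atLeast (suc n) b =
    subst (_≤ Σℕ (suc n) (λ k → signOf (b k))) (step (+ n))
          (ℤP.+-mono-≤ (-1≤signOf (b 0)) (Σ-atLeast n (λ k → b (suc k))))
    where step : ∀ n → - + 1 + - n ≡ - (+ 1 + n)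
          step = solve-∀

  Σ-onePlus : ∀ n c {b : ℕ → Bool} → c ℕ.< n → b c ≡ true → (∀ k → k ℕ.< n → k ≢ c → b k ≡ false) →
              Σℕ n (λ k → signOf (b k)) ≡ + 2 - + n
  Σ-onePlus (suc n) zero    _        b0 others =
    trans (cong₂ _+_ (cong signOf b0) (Σ-allMinus n (λ k k< → others (suc k) (s≤s k<) λ ())))
          (step (+ n))
    where step : ∀ n → + 1 + - n ≡ + 2 - (+ 1 + n)
          step = solve-∀
  Σ-onePlus (suc n) (suc c) (s≤s c<n) bc others =
    trans (cong₂ _+_ (cong signOf (others 0 (s≤s z≤n) λ ()))
                     (Σ-onePlus n c c<n bc (λ k k< k≢c → others (suc k) (s≤s k<) (k≢c ∘ ℕP.suc-injective))))
          (step (+ n))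
    where step : ∀ n → - + 1 + (+ 2 - n) ≡ + 2 - (+ 1 + n)
          step = solve-∀

  fromMatrix : ∀ {m n} → (ℕ → ℕ → Bool) → Labelling m n
  fromMatrix F (i , j) = toSign (F (toℕ i) (toℕ j))

  module Matrix {m n : ℕ} (F : ℕ → ℕ → Bool) where

    matrixRow : ℕ → ℤ
    matrixRow i = Σℕ n (λ j → signOf (F i j))

    matrixCol : ℕ → ℤ
    matrixCol j = Σℕ m (λ i → signOf (F i j))

    fromMatrix-weight : weight (fromMatrix {m} {n} F) ≡ Σℕ n matrixCol
    fromMatrix-weight =
      trans (weight-by-columns (fromMatrix {m} {n} F))
            (trans (ΣFin-cong n (λ j → ΣFin-toℕ m (λ i → signOf (F i (toℕ j))))) (ΣFin-toℕ n matrixCol))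

    fromMatrix-SEDF : (∀ i j → i ℕ.< m → j ℕ.< n → + 1 ≤ matrixRow i + matrixCol j - signOf (F i j)) →
                      IsSEDF (fromMatrix {m} {n} F)
    fromMatrix-SEDF ok (i , j) = subst (+ 1 ≤_) (sym nbhd≡) (ok (toℕ i) (toℕ j) (toℕ<n i) (toℕ<n j))
      where
      nbhd≡ : closedNbhdSum (fromMatrix {m} {n} F) (i , j)
              ≡ matrixRow (toℕ i) + matrixCol (toℕ j) - signOf (F (toℕ i) (toℕ j))
      nbhd≡ = trans (nbhd-decomposition (fromMatrix {m} {n} F) i j)
                    (cong₂ (λ r c → r + c - signOf (F (toℕ i) (toℕ j)))
                           (ΣFin-toℕ n (λ j' → signOf (F (toℕ i) j')))
                           (ΣFin-toℕ m (λ i' → signOf (F i' (toℕ j)))))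

  -- Column patterns: the sign of the entry in row i and column k of a block.
  -- diag o puts + exactly where i = o + k; lt a and ge a put + exactly in
  -- the rows i < a and i ≥ a respectively.
  data Pattern : Set where
    pos neg : Pattern
    diag    : ℕ → Pattern
    lt ge   : ℕ → Pattern

  ev : Pattern → ℕ → ℕ → Bool
  ev pos      i k = true
  ev neg      i k = false
  ev (diag o) i k = does (i ℕ.≟ o ℕ.+ k)
  ev (lt a)   i k = does (i ℕ.<? a)
  ev (ge a)   i k = does (a ℕ.≤? i)

  diag-row : ∀ o i s → o ℕ.≤ i → i ℕ.< o ℕ.+ s → Σℕ s (λ k → signOf (ev (diag o) i k)) ≡ + 2 - + s
  diag-row o i s o≤i i<o+s =
    Σ-onePlus s (i ∸ o) (ℕP.+-cancelˡ-< o _ _ (subst (ℕ._< o ℕ.+ s) (sym i≡) i<o+s))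
              (dec-true (i ℕ.≟ o ℕ.+ (i ∸ o)) (sym i≡))
              (λ k _ k≢ → dec-false (i ℕ.≟ o ℕ.+ k)
                                    (λ i≡o+k → k≢ (ℕP.+-cancelˡ-≡ o k (i ∸ o) (trans (sym i≡o+k) (sym i≡)))))
    where i≡ : o ℕ.+ (i ∸ o) ≡ i
          i≡ = ℕP.m+[n∸m]≡n o≤i

  diag-row-below : ∀ o i s → i ℕ.< o → Σℕ s (λ k → signOf (ev (diag o) i k)) ≡ - + s
  diag-row-below o i s i<o =
    Σ-allMinus s (λ k _ → dec-false (i ℕ.≟ o ℕ.+ k)
                                    (λ i≡ → ℕP.<-irrefl i≡ (ℕP.<-≤-trans i<o (ℕP.m≤m+n o k))))

  diag-row-above : ∀ o i s → o ℕ.+ s ℕ.≤ i → Σℕ s (λ k → signOf (ev (diag o) i k)) ≡ - + s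
  diag-row-above o i s o+s≤i =
    Σ-allMinus s (λ k k<s → dec-false (i ℕ.≟ o ℕ.+ k)
                                      (λ i≡ → ℕP.<-irrefl (sym i≡) (ℕP.<-≤-trans (ℕP.+-monoʳ-< o k<s) o+s≤i)))

  lt-row-in : ∀ a i s → i ℕ.< a → Σℕ s (λ k → signOf (ev (lt a) i k)) ≡ + s
  lt-row-in a i s i<a = Σ-allPlus s (λ _ _ → dec-true (i ℕ.<? a) i<a)

  lt-row-out : ∀ a i s → a ℕ.≤ i → Σℕ s (λ k → signOf (ev (lt a) i k)) ≡ - + s
  lt-row-out a i s a≤i = Σ-allMinus s (λ _ _ → dec-false (i ℕ.<? a) (ℕP.≤⇒≯ a≤i))

  ge-row-in : ∀ a i s → a ℕ.≤ i → Σℕ s (λ k → signOf (ev (ge a) i k)) ≡ + s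
  ge-row-in a i s a≤i = Σ-allPlus s (λ _ _ → dec-true (a ℕ.≤? i) a≤i)

  ge-row-out : ∀ a i s → i ℕ.< a → Σℕ s (λ k → signOf (ev (ge a) i k)) ≡ - + s
  ge-row-out a i s i<a = Σ-allMinus s (λ _ _ → dec-false (a ℕ.≤? i) (ℕP.<⇒≱ i<a))

  diag-col : ∀ o k M → o ℕ.+ k ℕ.< M → Σℕ M (λ i → signOf (ev (diag o) i k)) ≡ + 2 - + M
  diag-col o k M o+k<M =
    Σ-onePlus M (o ℕ.+ k) o+k<M (dec-true (o ℕ.+ k ℕ.≟ o ℕ.+ k) refl)
              (λ i _ i≢ → dec-false (i ℕ.≟ o ℕ.+ k) i≢)

  lt-col : ∀ a k M → a ℕ.≤ M → Σℕ M (λ i → signOf (ev (lt a) i k)) ≡ + a + + a - + M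
  lt-col a k M a≤M with excess a≤M
  ... | r , refl = begin
    Σℕ (a ℕ.+ r) (λ i → signOf (ev (lt a) i k))
      ≡⟨ Σℕ-split a r _ ⟩
    Σℕ a (λ i → signOf (ev (lt a) i k)) + Σℕ r (λ i → signOf (ev (lt a) (a ℕ.+ i) k))
      ≡⟨ cong₂ _+_ (Σ-allPlus a (λ i i<a → dec-true (i ℕ.<? a) i<a))
                   (Σ-allMinus r (λ i _ → dec-false (a ℕ.+ i ℕ.<? a) (ℕP.m+n≮m a i))) ⟩
    + a + - + r
      ≡⟨ form (+ a) (+ r) ⟩
    + a + + a - (+ a + + r)
    ∎
    where open ≡-Reasoning
          form : ∀ a r → a + - r ≡ a + a - (a + r)
          form = solve-∀

  ge-col : ∀ a k M → a ℕ.≤ M → Σℕ M (λ i → signOf (ev (ge a) i k)) ≡ + M - (+ a + + a)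
  ge-col a k M a≤M with excess a≤M
  ... | r , refl = begin
    Σℕ (a ℕ.+ r) (λ i → signOf (ev (ge a) i k))
      ≡⟨ Σℕ-split a r _ ⟩
    Σℕ a (λ i → signOf (ev (ge a) i k)) + Σℕ r (λ i → signOf (ev (ge a) (a ℕ.+ i) k))
      ≡⟨ cong₂ _+_ (Σ-allMinus a (λ i i<a → dec-false (a ℕ.≤? i) (ℕP.<⇒≱ i<a)))
                   (Σ-allPlus r (λ i _ → dec-true (a ℕ.≤? a ℕ.+ i) (ℕP.m≤m+n a i))) ⟩
    - + a + + r
      ≡⟨ form (+ a) (+ r) ⟩
    + a + + r - (+ a + + a)
    ∎
    where open ≡-Reasoning
          form : ∀ a r → - a + r ≡ a + r - (a + a)
          form = solve-∀

  -- A block of columns of a layout with M top rows, M bottom rows and e extra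
  -- rows: its width, the patterns of its top and bottom parts, and the
  -- constant sign of its entries in the extra rows.
  record Block : Set where
    constructor block
    field
      width  : ℕ
      top    : Pattern
      bottom : Pattern
      extra  : Bool
  open Block

  blockEntry : ℕ → Block → ℕ → ℕ → Bool
  blockEntry M b i k =
    if does (i ℕ.<? M) then ev (top b) i k
    else if does (i ℕ.<? M ℕ.+ M) then ev (bottom b) (i ∸ M) k
    else extra b

  entry : ℕ → List Block → ℕ → ℕ → Bool
  entry M []       i j = false
  entry M (b ∷ bs) i j =
    if does (j ℕ.<? width b) then blockEntry M b i j else entry M bs i (j ∸ width b)

  totalWidth : List Block → ℕ
  totalWidth []       = 0
  totalWidth (b ∷ bs) = width b ℕ.+ totalWidth bs

  entry-here : ∀ M b bs i k → k ℕ.< width b → entry M (b ∷ bs) i k ≡ blockEntry M b i k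
  entry-here M b bs i k k< =
    cong (λ c → if c then blockEntry M b i k else entry M bs i (k ∸ width b)) (dec-true (k ℕ.<? width b) k<)

  entry-there : ∀ M b bs i k → entry M (b ∷ bs) i (width b ℕ.+ k) ≡ entry M bs i k
  entry-there M b bs i k =
    trans (cong (λ c → if c then blockEntry M b i (width b ℕ.+ k) else entry M bs i (width b ℕ.+ k ∸ width b))
                (dec-false (width b ℕ.+ k ℕ.<? width b) (ℕP.m+n≮m (width b) k)))
          (cong (entry M bs i) (ℕP.m+n∸m≡n (width b) k))

  blockEntry-top : ∀ M b i k → i ℕ.< M → blockEntry M b i k ≡ ev (top b) i k
  blockEntry-top M b i k i<M =
    cong (λ c → if c then ev (top b) i k else rest) (dec-true (i ℕ.<? M) i<M)
    where rest = if does (i ℕ.<? M ℕ.+ M) then ev (bottom b) (i ∸ M) k else extra b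

  blockEntry-bottom : ∀ M b i k → i ℕ.< M → blockEntry M b (M ℕ.+ i) k ≡ ev (bottom b) i k
  blockEntry-bottom M b i k i<M =
    trans (cong (λ c → if c then ev (top b) (M ℕ.+ i) k else rest) (dec-false (M ℕ.+ i ℕ.<? M) (ℕP.m+n≮m M i)))
          (trans (cong (λ c → if c then ev (bottom b) (M ℕ.+ i ∸ M) k else extra b)
                       (dec-true (M ℕ.+ i ℕ.<? M ℕ.+ M) (ℕP.+-monoʳ-< M i<M)))
                 (cong (λ x → ev (bottom b) x k) (ℕP.m+n∸m≡n M i)))
    where rest = if does (M ℕ.+ i ℕ.<? M ℕ.+ M) then ev (bottom b) (M ℕ.+ i ∸ M) k else extra b

  blockEntry-extra : ∀ M b i k → blockEntry M b (M ℕ.+ (M ℕ.+ i)) k ≡ extra b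
  blockEntry-extra M b i k =
    trans (cong (λ c → if c then ev (top b) x k else rest) (dec-false (x ℕ.<? M) (ℕP.m+n≮m M (M ℕ.+ i))))
          (cong (λ c → if c then ev (bottom b) (x ∸ M) k else extra b)
                (dec-false (x ℕ.<? M ℕ.+ M) (ℕP.≤⇒≯ (ℕP.+-monoʳ-≤ M (ℕP.m≤m+n M i)))))
    where x = M ℕ.+ (M ℕ.+ i)
          rest = if does (x ℕ.<? M ℕ.+ M) then ev (bottom b) (x ∸ M) k else extra b

  rowSumOf : (Block → ℕ → Bool) → List Block → ℤ
  rowSumOf c []       = + 0
  rowSumOf c (b ∷ bs) = Σℕ (width b) (λ k → signOf (c b k)) + rowSumOf c bs

  rowSumOf-cong : ∀ {c c' : Block → ℕ → Bool} bs → (∀ b k → c b k ≡ c' b k) → rowSumOf c bs ≡ rowSumOf c' bs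
  rowSumOf-cong []       c≗c' = refl
  rowSumOf-cong (b ∷ bs) c≗c' =
    cong₂ _+_ (Σℕ-cong (width b) (λ k _ → cong signOf (c≗c' b k))) (rowSumOf-cong bs c≗c')

  entry-row : ∀ M bs i →
    Σℕ (totalWidth bs) (λ j → signOf (entry M bs i j)) ≡ rowSumOf (λ b k → blockEntry M b i k) bs
  entry-row M []       i = refl
  entry-row M (b ∷ bs) i =
    trans (Σℕ-split (width b) (totalWidth bs) _)
          (cong₂ _+_ (Σℕ-cong (width b) (λ k k< → cong signOf (entry-here M b bs i k k<)))
                     (trans (Σℕ-cong (totalWidth bs) (λ k _ → cong signOf (entry-there M b bs i k)))
                            (entry-row M bs i)))

  blockColSum : ℕ → ℕ → Block → ℕ → ℤ
  blockColSum M e b k =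
    Σℕ M (λ i → signOf (ev (top b) i k))
      + (Σℕ M (λ i → signOf (ev (bottom b) i k)) + Σℕ e (λ _ → signOf (extra b)))

  blockEntry-col : ∀ M e b k →
    Σℕ (M ℕ.+ (M ℕ.+ e)) (λ i → signOf (blockEntry M b i k)) ≡ blockColSum M e b k
  blockEntry-col M e b k =
    trans (Σℕ-split M (M ℕ.+ e) _)
          (cong₂ _+_ (Σℕ-cong M (λ i i< → cong signOf (blockEntry-top M b i k i<)))
                     (trans (Σℕ-split M e _)
                            (cong₂ _+_ (Σℕ-cong M (λ i i< → cong signOf (blockEntry-bottom M b i k i<)))
                                       (Σℕ-cong e (λ i _ → cong signOf (blockEntry-extra M b i k))))))

  locate : ∀ M bs j → j ℕ.< totalWidth bs →
           Σ[ b ∈ Block ] (b ∈ bs × Σ[ k ∈ ℕ ] (k ℕ.< width b × (∀ i → entry M bs i j ≡ blockEntry M b i k)))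
  locate M (b ∷ bs) j j< with j ℕ.<? width b
  ... | yes j<w = b , here refl , j , j<w , (λ i → entry-here M b bs i j j<w)
  ... | no  j≮w with excess (ℕP.≮⇒≥ j≮w)
  ...   | r , refl with locate M bs r (ℕP.+-cancelˡ-< (width b) r (totalWidth bs) j<)
  ...     | b' , b'∈bs , k , k< , same =
    b' , there b'∈bs , k , k< , (λ i → trans (entry-there M b bs i r) (same i))

  blocksColTotal : ℕ → ℕ → List Block → ℤ
  blocksColTotal M e []       = + 0
  blocksColTotal M e (b ∷ bs) = Σℕ (width b) (blockColSum M e b) + blocksColTotal M e bs

  entry-total : ∀ M e bs →
    Σℕ (totalWidth bs) (λ j → Σℕ (M ℕ.+ (M ℕ.+ e)) (λ i → signOf (entry M bs i j))) ≡ blocksColTotal M e bs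
  entry-total M e []       = refl
  entry-total M e (b ∷ bs) =
    trans (Σℕ-split (width b) (totalWidth bs) _)
          (cong₂ _+_ (Σℕ-cong (width b) (λ k k< →
                        trans (Σℕ-cong (M ℕ.+ (M ℕ.+ e)) (λ i _ → cong signOf (entry-here M b bs i k k<)))
                              (blockEntry-col M e b k)))
                     (trans (Σℕ-cong (totalWidth bs) (λ k _ →
                               Σℕ-cong (M ℕ.+ (M ℕ.+ e)) (λ i _ → cong signOf (entry-there M b bs i k))))
                            (entry-total M e bs)))

  -- The least value of ρ + κ that dominates a cell of the given pattern lying
  -- in a row of sum ρ and a column of sum κ: 0 for a − entry, 2 otherwise.
  need : Pattern → ℤ
  need neg = + 0
  need _   = + 2

  needᵇ : Bool → ℤ
  needᵇ false = + 0
  needᵇ true  = + 2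

  sign≤need : ∀ p i k → signOf (ev p i k) ≤ need p - + 1
  sign≤need pos      i k = ℤP.≤-refl
  sign≤need neg      i k = ℤP.≤-refl
  sign≤need (diag o) i k = signOf≤1 (ev (diag o) i k)
  sign≤need (lt a)   i k = signOf≤1 (ev (lt a) i k)
  sign≤need (ge a)   i k = signOf≤1 (ev (ge a) i k)

  signᵇ≤need : ∀ b → signOf b ≤ needᵇ b - + 1
  signᵇ≤need false = ℤP.≤-refl
  signᵇ≤need true  = ℤP.≤-refl

  cell-dominated : ∀ {R ρ κ s ν} → ρ ≤ R → s ≤ ν - + 1 → ν ≤ ρ + κ → + 1 ≤ R + κ - s
  cell-dominated {R} {ρ} {κ} {s} {ν} ρ≤R s≤ν-1 ν≤ρ+κ = begin
    + 1                ≡⟨ form ν ⟩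
    ν - (ν - + 1)      ≤⟨ ℤP.+-monoˡ-≤ (- (ν - + 1)) ν≤ρ+κ ⟩
    ρ + κ - (ν - + 1)  ≤⟨ ℤP.+-mono-≤ (ℤP.+-monoˡ-≤ κ ρ≤R) (ℤP.neg-mono-≤ s≤ν-1) ⟩
    R + κ - s          ∎
    where open ℤP.≤-Reasoning
          form : ∀ ν → + 1 ≡ ν - (ν - + 1)
          form = solve-∀

  module Layout (M e : ℕ) (bs : List Block) where

    matrix : ℕ → ℕ → Bool
    matrix = entry M bs

    open Matrix {M ℕ.+ (M ℕ.+ e)} {totalWidth bs} matrix

    topRow bottomRow : ℕ → ℤ
    topRow    i = rowSumOf (λ b k → ev (top b) i k) bs
    bottomRow i = rowSumOf (λ b k → ev (bottom b) i k) bs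

    extraRow : ℤ
    extraRow = rowSumOf (λ b k → extra b) bs

    Good : Block → Set
    Good b = ∀ k → k ℕ.< width b →
      (∀ i → i ℕ.< M → + 1 ≤ topRow i + blockColSum M e b k - signOf (ev (top b) i k)) ×
      (∀ i → i ℕ.< M → + 1 ≤ bottomRow i + blockColSum M e b k - signOf (ev (bottom b) i k)) ×
      (0 ℕ.< e → + 1 ≤ extraRow + blockColSum M e b k - signOf (extra b))

    rowCases : ∀ i → i ℕ.< M ℕ.+ (M ℕ.+ e) →
        (i ℕ.< M)
      ⊎ (Σ[ i' ∈ ℕ ] (i' ℕ.< M × i ≡ M ℕ.+ i'))
      ⊎ (0 ℕ.< e × Σ[ i' ∈ ℕ ] i ≡ M ℕ.+ (M ℕ.+ i'))
    rowCases i i< with i ℕ.<? M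
    ... | yes i<M = inj₁ i<M
    ... | no  i≮M with excess (ℕP.≮⇒≥ i≮M)
    ...   | r , refl with r ℕ.<? M
    ...     | yes r<M = inj₂ (inj₁ (r , r<M , refl))
    ...     | no  r≮M with excess (ℕP.≮⇒≥ r≮M)
    ...       | s , refl = inj₂ (inj₂ (0<e , s , refl))
      where 0<e : 0 ℕ.< e
            0<e = ℕP.≤-<-trans z≤n (ℕP.+-cancelˡ-< M s e (ℕP.+-cancelˡ-< M (M ℕ.+ s) (M ℕ.+ e) i<))

    layout-SEDF : All Good bs → IsSEDF (fromMatrix {M ℕ.+ (M ℕ.+ e)} {totalWidth bs} matrix)
    layout-SEDF allGood = fromMatrix-SEDF cellOK
      where
      cellOK : ∀ i j → i ℕ.< M ℕ.+ (M ℕ.+ e) → j ℕ.< totalWidth bs →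
               + 1 ≤ matrixRow i + matrixCol j - signOf (matrix i j)
      cellOK i j i< j< with locate M bs j j<
      ... | b , b∈bs , k , k< , same = subst (+ 1 ≤_) (sym toBlock) (rowOK i i<)
        where
        good = All.lookup allGood b∈bs k k<
        κ = blockColSum M e b k
        toBlock : matrixRow i + matrixCol j - signOf (matrix i j)
                  ≡ rowSumOf (λ b' k' → blockEntry M b' i k') bs + κ - signOf (blockEntry M b i k)
        toBlock = cong₂ _-_ (cong₂ _+_ (entry-row M bs i)
                                       (trans (Σℕ-cong (M ℕ.+ (M ℕ.+ e)) (λ i' _ → cong signOf (same i')))
                                              (blockEntry-col M e b k)))
                            (cong signOf (same i))
        rowOK : ∀ i → i ℕ.< M ℕ.+ (M ℕ.+ e) →
                + 1 ≤ rowSumOf (λ b' k' → blockEntry M b' i k') bs + κ - signOf (blockEntry M b i k)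
        rowOK i i< with rowCases i i<
        ... | inj₁ i<M =
          subst₂ (λ R s → + 1 ≤ R + κ - s)
                 (rowSumOf-cong bs (λ b' k' → sym (blockEntry-top M b' i k' i<M)))
                 (cong signOf (sym (blockEntry-top M b i k i<M)))
                 (proj₁ good i i<M)
        ... | inj₂ (inj₁ (i' , i'<M , refl)) =
          subst₂ (λ R s → + 1 ≤ R + κ - s)
                 (rowSumOf-cong bs (λ b' k' → sym (blockEntry-bottom M b' i' k' i'<M)))
                 (cong signOf (sym (blockEntry-bottom M b i' k i'<M)))
                 (proj₁ (proj₂ good) i' i'<M)
        ... | inj₂ (inj₂ (0<e , i' , refl)) =
          subst₂ (λ R s → + 1 ≤ R + κ - s)
                 (rowSumOf-cong bs (λ b' k' → sym (blockEntry-extra M b' i' k')))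
                 (cong signOf (sym (blockEntry-extra M b i' k)))
                 (proj₂ (proj₂ good) 0<e)

    record RowBounds : Set where
      field
        topLB bottomLB extraLB : ℤ
        top≤    : ∀ i → i ℕ.< M → topLB ≤ topRow i
        bottom≤ : ∀ i → i ℕ.< M → bottomLB ≤ bottomRow i
        extra≤  : 0 ℕ.< e → extraLB ≤ extraRow

    module Checked (ρ : RowBounds) where
      open RowBounds ρ

      record CheckedBlock (b : Block) : Set where
        constructor checked
        field
          columnSum : ℤ
          columnSum≡ : ∀ k → k ℕ.< width b → blockColSum M e b k ≡ columnSum
          topOK      : need (top b) ≤ topLB + columnSum
          bottomOK   : need (bottom b) ≤ bottomLB + columnSum
          extraOK    : 0 ℕ.< e → needᵇ (extra b) ≤ extraLB + columnSum
      open CheckedBlock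

      checked⇒Good : ∀ {b} → CheckedBlock b → Good b
      checked⇒Good {b} chk k k< =
          (λ i i<M → dominated (top≤ i i<M) (sign≤need (top b) i k) (topOK chk))
        , (λ i i<M → dominated (bottom≤ i i<M) (sign≤need (bottom b) i k) (bottomOK chk))
        , (λ 0<e → dominated (extra≤ 0<e) (signᵇ≤need (extra b)) (extraOK chk 0<e))
        where
        dominated : ∀ {R ρ s ν} → ρ ≤ R → s ≤ ν - + 1 → ν ≤ ρ + columnSum chk →
                    + 1 ≤ R + blockColSum M e b k - s
        dominated {R} {s = s} ρ≤R s≤ν-1 ν≤ =
          subst (λ c → + 1 ≤ R + c - s) (sym (columnSum≡ chk k k<)) (cell-dominated ρ≤R s≤ν-1 ν≤)

      checkedTotal : ∀ {cs} → All CheckedBlock cs → ℤ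
      checkedTotal []                = + 0
      checkedTotal {b ∷ _} (c ∷ chk) = + width b * columnSum c + checkedTotal chk

      blocksColTotal-checked : ∀ {cs} (chk : All CheckedBlock cs) → blocksColTotal M e cs ≡ checkedTotal chk
      blocksColTotal-checked []                = refl
      blocksColTotal-checked {b ∷ _} (c ∷ chk) =
        cong₂ _+_ (Σℕ-constOn (width b) (columnSum c) (columnSum≡ c)) (blocksColTotal-checked chk)

      design : (chk : All CheckedBlock bs) → HasSEDF (M ℕ.+ (M ℕ.+ e)) (totalWidth bs) (checkedTotal chk)
      design chk = fromMatrix matrix , layout-SEDF (All.map checked⇒Good chk)
                 , trans fromMatrix-weight (trans (entry-total M e bs) (blocksColTotal-checked chk))

  ≤! : ∀ {a b} {ok : True (a ℤP.≤? b)} → a ≤ b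
  ≤! {ok = ok} = toWitness ok

  infixr 5 _⊕_ _⟨+⟩_
  _⊕_ : ∀ {a b c d} → a ≤ b → c ≤ d → a + c ≤ b + d
  _⊕_ = ℤP.+-mono-≤

  _⟨+⟩_ : ∀ {a b c d : ℤ} → a ≡ b → c ≡ d → a + c ≡ b + d
  _⟨+⟩_ = cong₂ _+_

  exactly : ∀ {x v} → x ≡ v → v ≤ x
  exactly x≡v = ℤP.≤-reflexive (sym x≡v)

  via : ∀ {a b c} → a ≡ b → b ≤ c → a ≤ c
  via a≡b b≤c = subst (_≤ _) (sym a≡b) b≤c

  noMore : + 0 ≡ + 0
  noMore = refl

  noMore≤ : + 0 ≤ + 0
  noMore≤ = ℤP.≤-refl

  plusses : ∀ n → Σℕ n (λ _ → + 1) ≡ + n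
  plusses n = Σ-allPlus n (λ _ _ → refl)

  minuses : ∀ n → Σℕ n (λ _ → - + 1) ≡ - + n
  minuses n = Σ-allMinus n (λ _ _ → refl)

  nonEmpty : ∀ {k t M} → k ℕ.< t → t ℕ.≤ M → 1 ℕ.≤ M
  nonEmpty k<t t≤M = ℕP.≤-trans (s≤s z≤n) (ℕP.≤-trans k<t t≤M)

  extraSum : ℕ → Bool → ℤ
  extraSum e x = Σℕ e (λ _ → signOf x)

  upDownCol : ∀ M e w x k → blockColSum M e (block w pos neg x) k ≡ extraSum e x
  upDownCol M e w x k = trans (plusses M ⟨+⟩ minuses M ⟨+⟩ refl) (cancel (+ M) (extraSum e x))
    where cancel : ∀ M x → M + (- M + x) ≡ x
          cancel = solve-∀

  downUpCol : ∀ M e w x k → blockColSum M e (block w neg pos x) k ≡ extraSum e x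
  downUpCol M e w x k = trans (minuses M ⟨+⟩ plusses M ⟨+⟩ refl) (cancel (+ M) (extraSum e x))
    where cancel : ∀ M x → - M + (M + x) ≡ x
          cancel = solve-∀

  diagUpCol : ∀ M e o w x {k} → o ℕ.+ k ℕ.< M →
              blockColSum M e (block w (diag o) pos x) k ≡ + 2 + extraSum e x
  diagUpCol M e o w x {k} o+k<M =
    trans (diag-col o k M o+k<M ⟨+⟩ plusses M ⟨+⟩ refl) (cancel (+ M) (extraSum e x))
    where cancel : ∀ M x → (+ 2 - M) + (M + x) ≡ + 2 + x
          cancel = solve-∀

  upDiagCol : ∀ M e w x {k} → k ℕ.< M → blockColSum M e (block w pos (diag 0) x) k ≡ + 2 + extraSum e x
  upDiagCol M e w x {k} k<M =
    trans (plusses M ⟨+⟩ diag-col 0 k M k<M ⟨+⟩ refl) (cancel (+ M) (extraSum e x))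
    where cancel : ∀ M x → M + ((+ 2 - M) + x) ≡ + 2 + x
          cancel = solve-∀

  prefixUpCol : ∀ M e a w x k → a ℕ.≤ M →
                blockColSum M e (block w (lt a) pos x) k ≡ (+ a + + a) + extraSum e x
  prefixUpCol M e a w x k a≤M =
    trans (lt-col a k M a≤M ⟨+⟩ plusses M ⟨+⟩ refl) (cancel (+ a) (+ M) (extraSum e x))
    where cancel : ∀ a M x → (a + a - M) + (M + x) ≡ (a + a) + x
          cancel = solve-∀

  -- m = 2M, n = 2(M + t) with t ≤ M: weight n.  The top rows carry a
  -- diagonal block and one row of + in a block of width t; the bottom rows
  -- are balanced, and columns sum to 2 or 0.
  module MidEven (M t : ℕ) (t≤M : t ℕ.≤ M) where

    blocks : List Block
    blocks = block M (diag 0) pos false ∷ block t (lt 1) pos false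
           ∷ block M pos neg false ∷ block t pos neg false ∷ []

    open Layout M 0 blocks

    bounds : RowBounds
    bounds = record
      { topLB = + 2 ; bottomLB = + 0 ; extraLB = + 0
      ; top≤ = λ i i<M → via (form (+ M) (+ t))
          (exactly (diag-row 0 i M z≤n i<M) ⊕ Σ-atLeast t (λ k → ev (lt 1) i k)
            ⊕ exactly (plusses M) ⊕ exactly (plusses t) ⊕ noMore≤)
      ; bottom≤ = λ i _ → exactly (trans (plusses M ⟨+⟩ plusses t ⟨+⟩ minuses M ⟨+⟩ minuses t ⟨+⟩ noMore)
                                         (balanced (+ M) (+ t)))
      ; extra≤ = λ () }
      where
      form : ∀ M t → + 2 ≡ (+ 2 - M) + (- t + (M + (t + + 0)))
      form = solve-∀
      balanced : ∀ M t → M + (t + (- M + (- t + + 0))) ≡ + 0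
      balanced = solve-∀

    open Checked bounds

    checks : All CheckedBlock blocks
    checks = checked (+ 2) (λ k k<M → diagUpCol M 0 0 M false k<M) ≤! ≤! (λ ())
           ∷ checked (+ 2) (λ k k<t → prefixUpCol M 0 1 t false k (nonEmpty k<t t≤M)) ≤! ≤! (λ ())
           ∷ checked (+ 0) (λ k _ → upDownCol M 0 M false k) ≤! ≤! (λ ())
           ∷ checked (+ 0) (λ k _ → upDownCol M 0 t false k) ≤! ≤! (λ ())
           ∷ []

    sedf : HasSEDF (M ℕ.+ M) ((M ℕ.+ t) ℕ.+ (M ℕ.+ t)) (+ ((M ℕ.+ t) ℕ.+ (M ℕ.+ t)))
    sedf = HasSEDF-cast (rows M) (columns M t) (total (+ M) (+ t)) (design checks)
      where
      rows : ∀ M → M ℕ.+ M ≡ M ℕ.+ (M ℕ.+ 0)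
      rows = ℕ-solve
      columns : ∀ M t → (M ℕ.+ t) ℕ.+ (M ℕ.+ t) ≡ M ℕ.+ (t ℕ.+ (M ℕ.+ (t ℕ.+ 0)))
      columns = ℕ-solve
      total : ∀ M t → (M + t) + (M + t) ≡ M * + 2 + (t * + 2 + (M * + 0 + (t * + 0 + + 0)))
      total = solve-∀

  -- m = 2M + 1, n = 2(M + t) + 1 with t ≤ M: weight n.  MidEven with one
  -- extra row and one extra column; all rows and columns sum to 1.
  module MidOdd (M t : ℕ) (t≤M : t ℕ.≤ M) where

    blocks : List Block
    blocks = block M (diag 0) pos false ∷ block t (lt 1) pos false
           ∷ block M pos neg true ∷ block t pos neg true ∷ block 1 neg pos true ∷ []

    open Layout M 1 blocks

    bounds : RowBounds
    bounds = record
      { topLB = + 1 ; bottomLB = + 1 ; extraLB = + 1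
      ; top≤ = λ i i<M → via (form (+ M) (+ t))
          (exactly (diag-row 0 i M z≤n i<M) ⊕ Σ-atLeast t (λ k → ev (lt 1) i k)
            ⊕ exactly (plusses M) ⊕ exactly (plusses t) ⊕ exactly (minuses 1) ⊕ noMore≤)
      ; bottom≤ = λ i _ → exactly (trans (plusses M ⟨+⟩ plusses t ⟨+⟩ minuses M ⟨+⟩ minuses t
                                            ⟨+⟩ plusses 1 ⟨+⟩ noMore)
                                         (bottomSum (+ M) (+ t)))
      ; extra≤ = λ _ → exactly (trans (minuses M ⟨+⟩ minuses t ⟨+⟩ plusses M ⟨+⟩ plusses t
                                         ⟨+⟩ plusses 1 ⟨+⟩ noMore)
                                      (extraRowSum (+ M) (+ t))) }
      where
      form : ∀ M t → + 1 ≡ (+ 2 - M) + (- t + (M + (t + (- + 1 + + 0))))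
      form = solve-∀
      bottomSum : ∀ M t → M + (t + (- M + (- t + (+ 1 + + 0)))) ≡ + 1
      bottomSum = solve-∀
      extraRowSum : ∀ M t → - M + (- t + (M + (t + (+ 1 + + 0)))) ≡ + 1
      extraRowSum = solve-∀

    open Checked bounds

    checks : All CheckedBlock blocks
    checks = checked (+ 1) (λ k k<M → diagUpCol M 1 0 M false k<M) ≤! ≤! (λ _ → ≤!)
           ∷ checked (+ 1) (λ k k<t → prefixUpCol M 1 1 t false k (nonEmpty k<t t≤M)) ≤! ≤! (λ _ → ≤!)
           ∷ checked (+ 1) (λ k _ → upDownCol M 1 M true k) ≤! ≤! (λ _ → ≤!)
           ∷ checked (+ 1) (λ k _ → upDownCol M 1 t true k) ≤! ≤! (λ _ → ≤!)
           ∷ checked (+ 1) (λ k _ → downUpCol M 1 1 true k) ≤! ≤! (λ _ → ≤!)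
           ∷ []

    sedf : HasSEDF (suc (M ℕ.+ M)) (suc ((M ℕ.+ t) ℕ.+ (M ℕ.+ t))) (+ suc ((M ℕ.+ t) ℕ.+ (M ℕ.+ t)))
    sedf = HasSEDF-cast (rows M) (columns M t) (total (+ M) (+ t)) (design checks)
      where
      rows : ∀ M → suc (M ℕ.+ M) ≡ M ℕ.+ (M ℕ.+ 1)
      rows = ℕ-solve
      columns : ∀ M t → suc ((M ℕ.+ t) ℕ.+ (M ℕ.+ t)) ≡ M ℕ.+ (t ℕ.+ (M ℕ.+ (t ℕ.+ (1 ℕ.+ 0))))
      columns = ℕ-solve
      total : ∀ M t → + 1 + ((M + t) + (M + t))
                      ≡ M * + 1 + (t * + 1 + (M * + 1 + (t * + 1 + (+ 1 * + 1 + + 0))))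
      total = solve-∀

  twoMinusTwice : ∀ e → e ℕ.≤ 1 → + 0 ≤ (+ 2 - + e) + - + e
  twoMinusTwice zero          _          = ≤!
  twoMinusTwice (suc zero)    _          = ≤!
  twoMinusTwice (suc (suc _)) (s≤s ())

  -- m = 2M + e (e ≤ 1), n = k + e + 2u (k ≥ 2): weight k·m − e.  Here k
  -- columns are entirely +, and u + e columns (+ on top, − below) are
  -- balanced by u columns (− on top, + below).
  module Large (M e k u : ℕ) (e≤1 : e ℕ.≤ 1) (2≤k : 2 ℕ.≤ k) where

    blocks : List Block
    blocks = block k pos pos true ∷ block (u ℕ.+ e) pos neg false ∷ block u neg pos true ∷ []

    open Layout M e blocks

    bounds : RowBounds
    bounds = record
      { topLB = + 2 + + e ; bottomLB = + 2 - + e ; extraLB = + 2 - + e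
      ; top≤ = λ i _ → subst (+ 2 + + e ≤_) (sym topSum) (ℤP.+-monoˡ-≤ (+ e) (+≤+ 2≤k))
      ; bottom≤ = λ i _ → subst (+ 2 - + e ≤_) (sym bottomSum) (ℤP.+-monoˡ-≤ (- + e) (+≤+ 2≤k))
      ; extra≤ = λ _ → subst (+ 2 - + e ≤_) (sym bottomSum) (ℤP.+-monoˡ-≤ (- + e) (+≤+ 2≤k)) }
      where
      topForm : ∀ k u e → k + ((u + e) + (- u + + 0)) ≡ k + e
      topForm = solve-∀
      bottomForm : ∀ k u e → k + (- (u + e) + (u + + 0)) ≡ k - e
      bottomForm = solve-∀
      topSum : Σℕ k (λ _ → + 1) + (Σℕ (u ℕ.+ e) (λ _ → + 1) + (Σℕ u (λ _ → - + 1) + + 0)) ≡ + k + + e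
      topSum = trans (plusses k ⟨+⟩ plusses (u ℕ.+ e) ⟨+⟩ minuses u ⟨+⟩ noMore) (topForm (+ k) (+ u) (+ e))
      bottomSum : Σℕ k (λ _ → + 1) + (Σℕ (u ℕ.+ e) (λ _ → - + 1) + (Σℕ u (λ _ → + 1) + + 0)) ≡ + k - + e
      bottomSum = trans (plusses k ⟨+⟩ minuses (u ℕ.+ e) ⟨+⟩ plusses u ⟨+⟩ noMore) (bottomForm (+ k) (+ u) (+ e))

    open Checked bounds

    checks : All CheckedBlock blocks
    checks = checked (+ M + (+ M + + e)) (λ _ _ → plusses M ⟨+⟩ plusses M ⟨+⟩ plusses e)
                     (+≤+ (ℕP.≤-trans (ℕP.m≤m+n 2 e) (ℕP.m≤m+n (2 ℕ.+ e) _)))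
                     (slack (M ℕ.+ M) (allPlusBottom (+ M) (+ e)))
                     (λ _ → slack (M ℕ.+ M) (allPlusBottom (+ M) (+ e)))
           ∷ checked (- + e) (λ k _ → trans (upDownCol M e (u ℕ.+ e) false k) (minuses e))
                     (slack 0 (downTop (+ e))) (twoMinusTwice e e≤1) (λ _ → twoMinusTwice e e≤1)
           ∷ checked (+ e) (λ k _ → trans (downUpCol M e u true k) (plusses e))
                     (+≤+ z≤n) (slack 0 (upBottom (+ e))) (λ _ → slack 0 (upBottom (+ e)))
           ∷ []
      where
      slack : ∀ {a b} s → b ≡ a + + s → a ≤ b
      slack {a} s b≡ = subst (a ≤_) (sym b≡) (ℤP.i≤i+j a (+ s))
      allPlusBottom : ∀ M e → (+ 2 - e) + (M + (M + e)) ≡ + 2 + (M + M)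
      allPlusBottom = solve-∀
      downTop : ∀ e → (+ 2 + e) + - e ≡ + 2 + + 0
      downTop = solve-∀
      upBottom : ∀ e → (+ 2 - e) + e ≡ + 2 + + 0
      upBottom = solve-∀

    sedf : HasSEDF (e ℕ.+ (M ℕ.+ M)) (e ℕ.+ (k ℕ.+ (u ℕ.+ u))) (+ (k ℕ.* (e ℕ.+ (M ℕ.+ M)) ∸ e))
    sedf = HasSEDF-cast (rows M e) (columns k u e) weight≡ (design checks)
      where
      rows : ∀ M e → e ℕ.+ (M ℕ.+ M) ≡ M ℕ.+ (M ℕ.+ e)
      rows = ℕ-solve
      columns : ∀ k u e → e ℕ.+ (k ℕ.+ (u ℕ.+ u)) ≡ k ℕ.+ (u ℕ.+ e ℕ.+ (u ℕ.+ 0))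
      columns = ℕ-solve
      m = e ℕ.+ (M ℕ.+ M)
      e≤km : e ℕ.≤ k ℕ.* m
      e≤km = ℕP.≤-trans (ℕP.m≤m+n e (M ℕ.+ M))
                        (ℕP.m≤n*m m k {{ℕ.>-nonZero (ℕP.<-≤-trans (s≤s z≤n) 2≤k)}})
      square : ∀ e → e ℕ.≤ 1 → + e * + e ≡ + e
      square zero          _ = refl
      square (suc zero)    _ = refl
      square (suc (suc _)) (s≤s ())
      expand : ∀ M k u e → k * (e + (M + M)) - e * e ≡ k * (M + (M + e)) + ((u + e) * - e + (u * e + + 0))
      expand = solve-∀
      weight≡ : + (k ℕ.* m ∸ e) ≡ checkedTotal checks
      weight≡ = begin
        + (k ℕ.* m ∸ e)              ≡⟨ pos-∸ (k ℕ.* m) e e≤km ⟩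
        + (k ℕ.* m) - + e            ≡⟨ cong₂ _-_ (ℤP.pos-* k m) (sym (square e e≤1)) ⟩
        + k * + m - + e * + e        ≡⟨ expand (+ M) (+ k) (+ u) (+ e) ⟩
        checkedTotal checks          ∎
        where open ≡-Reasoning

  -- m = 2M with M = 1 + t + h, n = 2(M + t) + 1: weight 2m.  Top rows sum
  -- to 3, bottom rows to 1; the columns of the first three blocks sum to 0,
  -- all others to 2.
  module LowEvenOdd (t h : ℕ) where

    M : ℕ
    M = suc (t ℕ.+ h)

    blocks : List Block
    blocks = block t pos neg false ∷ block t pos neg false ∷ block 1 pos neg false
           ∷ block M (diag 0) pos false ∷ block h pos (diag 0) false
           ∷ block 1 (lt (suc h)) (ge h) false ∷ block t (diag (suc h)) pos false ∷ []

    open Layout M 0 blocks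

    topSum : ∀ i → i ℕ.< M → topRow i ≡ + 3
    topSum i i<M with i ℕ.<? suc h
    ... | yes i≤h = trans (plusses t ⟨+⟩ plusses t ⟨+⟩ plusses 1 ⟨+⟩ diag-row 0 i M z≤n i<M ⟨+⟩ plusses h
                             ⟨+⟩ lt-row-in (suc h) i 1 i≤h ⟨+⟩ diag-row-below (suc h) i t i≤h ⟨+⟩ noMore)
                          (rowValue (+ t) (+ h))
      where rowValue : ∀ t h → t + (t + (+ 1 + ((+ 2 - (+ 1 + (t + h))) + (h + (+ 1 + (- t + + 0)))))) ≡ + 3
            rowValue = solve-∀
    ... | no  i≰h = trans (plusses t ⟨+⟩ plusses t ⟨+⟩ plusses 1 ⟨+⟩ diag-row 0 i M z≤n i<M ⟨+⟩ plusses h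
                             ⟨+⟩ lt-row-out (suc h) i 1 h<i ⟨+⟩ diag-row (suc h) i t h<i i<h+1+t ⟨+⟩ noMore)
                          (rowValue (+ t) (+ h))
      where h<i = ℕP.≮⇒≥ i≰h
            i<h+1+t = subst (λ x → i ℕ.< suc x) (ℕP.+-comm t h) i<M
            rowValue : ∀ t h → t + (t + (+ 1 + ((+ 2 - (+ 1 + (t + h))) + (h + (- + 1 + ((+ 2 - t) + + 0)))))) ≡ + 3
            rowValue = solve-∀

    bottomSum : ∀ i → bottomRow i ≡ + 1
    bottomSum i with i ℕ.<? h
    ... | yes i<h = trans (minuses t ⟨+⟩ minuses t ⟨+⟩ minuses 1 ⟨+⟩ plusses M ⟨+⟩ diag-row 0 i h z≤n i<h
                             ⟨+⟩ ge-row-out h i 1 i<h ⟨+⟩ plusses t ⟨+⟩ noMore)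
                          (rowValue (+ t) (+ h))
      where rowValue : ∀ t h → - t + (- t + (- + 1 + ((+ 1 + (t + h)) + ((+ 2 - h) + (- + 1 + (t + + 0)))))) ≡ + 1
            rowValue = solve-∀
    ... | no  i≮h = trans (minuses t ⟨+⟩ minuses t ⟨+⟩ minuses 1 ⟨+⟩ plusses M ⟨+⟩ diag-row-above 0 i h h≤i
                             ⟨+⟩ ge-row-in h i 1 h≤i ⟨+⟩ plusses t ⟨+⟩ noMore)
                          (rowValue (+ t) (+ h))
      where h≤i = ℕP.≮⇒≥ i≮h
            rowValue : ∀ t h → - t + (- t + (- + 1 + ((+ 1 + (t + h)) + (- h + (+ 1 + (t + + 0)))))) ≡ + 1
            rowValue = solve-∀

    bounds : RowBounds
    bounds = record
      { topLB = + 3 ; bottomLB = + 1 ; extraLB = + 0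
      ; top≤ = λ i i<M → exactly (topSum i i<M)
      ; bottom≤ = λ i _ → exactly (bottomSum i)
      ; extra≤ = λ () }

    open Checked bounds

    h<M : h ℕ.< M
    h<M = s≤s (ℕP.m≤n+m h t)

    checks : All CheckedBlock blocks
    checks = balanced t ∷ balanced t ∷ balanced 1
           ∷ checked (+ 2) (λ k k<M → diagUpCol M 0 0 M false k<M) ≤! ≤! (λ ())
           ∷ checked (+ 2) (λ k k<h → upDiagCol M 0 h false (ℕP.<-trans k<h h<M)) ≤! ≤! (λ ())
           ∷ checked (+ 2) (λ k _ → trans (lt-col (suc h) k M h<M ⟨+⟩ ge-col h k M (ℕP.<⇒≤ h<M) ⟨+⟩ noMore)
                                          (steps (+ h) (+ M)))
                     ≤! ≤! (λ ())
           ∷ checked (+ 2) (λ k k<t → diagUpCol M 0 (suc h) t false (shifted k<t)) ≤! ≤! (λ ())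
           ∷ []
      where
      balanced : ∀ w → CheckedBlock (block w pos neg false)
      balanced w = checked (+ 0) (λ k _ → upDownCol M 0 w false k) ≤! ≤! (λ ())
      shifted : ∀ {k} → k ℕ.< t → suc h ℕ.+ k ℕ.< M
      shifted {k} k<t = s≤s (subst (h ℕ.+ k ℕ.<_) (ℕP.+-comm h t) (ℕP.+-monoʳ-< h k<t))
      steps : ∀ h M → ((+ 1 + h) + (+ 1 + h) - M) + ((M - (h + h)) + + 0) ≡ + 2
      steps = solve-∀

    sedf : HasSEDF (M ℕ.+ M) (suc ((M ℕ.+ t) ℕ.+ (M ℕ.+ t))) (+ (2 ℕ.* (M ℕ.+ M)))
    sedf = HasSEDF-cast (rows M) (columns t h) (total (+ t) (+ h)) (design checks)
      where
      rows : ∀ M → M ℕ.+ M ≡ M ℕ.+ (M ℕ.+ 0)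
      rows = ℕ-solve
      columns : ∀ t h → suc ((suc (t ℕ.+ h) ℕ.+ t) ℕ.+ (suc (t ℕ.+ h) ℕ.+ t))
                      ≡ t ℕ.+ (t ℕ.+ (1 ℕ.+ (suc (t ℕ.+ h) ℕ.+ (h ℕ.+ (1 ℕ.+ (t ℕ.+ 0))))))
      columns = ℕ-solve
      total : ∀ t h → let M = + 1 + (t + h) in
              (M + M) + ((M + M) + + 0)
                ≡ t * + 0 + (t * + 0 + (+ 1 * + 0 + (M * + 2 + (h * + 2 + (+ 1 * + 2 + (t * + 2 + + 0))))))
      total = solve-∀

  -- m = 2M with M = 1 + M', n = 4M + 2r + 1: weight n + 1.  Two diagonal
  -- blocks and a row of + make the top rows sum to 3.
  module MidEvenOdd (M' r : ℕ) where

    M : ℕ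
    M = suc M'

    blocks : List Block
    blocks = block (M ℕ.+ M' ℕ.+ suc r) pos neg false ∷ block M (diag 0) pos false
           ∷ block M (diag 0) pos false ∷ block (suc r) (lt 1) pos false ∷ []

    open Layout M 0 blocks

    bounds : RowBounds
    bounds = record
      { topLB = + 3 ; bottomLB = + 1 ; extraLB = + 0
      ; top≤ = λ i i<M → via (form (+ M') (+ r))
          (exactly (plusses (M ℕ.+ M' ℕ.+ suc r)) ⊕ exactly (diag-row 0 i M z≤n i<M)
            ⊕ exactly (diag-row 0 i M z≤n i<M) ⊕ Σ-atLeast (suc r) (λ k → ev (lt 1) i k) ⊕ noMore≤)
      ; bottom≤ = λ i _ → exactly (trans (minuses (M ℕ.+ M' ℕ.+ suc r) ⟨+⟩ plusses M ⟨+⟩ plusses M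
                                            ⟨+⟩ plusses (suc r) ⟨+⟩ noMore)
                                         (bottomSum (+ M') (+ r)))
      ; extra≤ = λ () }
      where
      form : ∀ M' r → let M = + 1 + M' in
             + 3 ≡ (M + M' + (+ 1 + r)) + ((+ 2 - M) + ((+ 2 - M) + (- (+ 1 + r) + + 0)))
      form = solve-∀
      bottomSum : ∀ M' r → let M = + 1 + M' in
                  - (M + M' + (+ 1 + r)) + (M + (M + ((+ 1 + r) + + 0))) ≡ + 1
      bottomSum = solve-∀

    open Checked bounds

    checks : All CheckedBlock blocks
    checks = checked (+ 0) (λ k _ → upDownCol M 0 (M ℕ.+ M' ℕ.+ suc r) false k) ≤! ≤! (λ ())
           ∷ checked (+ 2) (λ k k<M → diagUpCol M 0 0 M false k<M) ≤! ≤! (λ ())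
           ∷ checked (+ 2) (λ k k<M → diagUpCol M 0 0 M false k<M) ≤! ≤! (λ ())
           ∷ checked (+ 2) (λ k _ → prefixUpCol M 0 1 (suc r) false k (s≤s z≤n)) ≤! ≤! (λ ())
           ∷ []

    N : ℕ
    N = M ℕ.+ (M ℕ.+ r)

    sedf : HasSEDF (M ℕ.+ M) (suc (N ℕ.+ N)) (+ (suc (N ℕ.+ N) ℕ.+ 1))
    sedf = HasSEDF-cast (rows M) (columns M' r) (total (+ M') (+ r)) (design checks)
      where
      rows : ∀ M → M ℕ.+ M ≡ M ℕ.+ (M ℕ.+ 0)
      rows = ℕ-solve
      columns : ∀ M' r → let M = suc M' ; N = M ℕ.+ (M ℕ.+ r) in
                suc (N ℕ.+ N) ≡ (M ℕ.+ M' ℕ.+ suc r) ℕ.+ (M ℕ.+ (M ℕ.+ (suc r ℕ.+ 0)))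
      columns = ℕ-solve
      total : ∀ M' r → let M = + 1 + M' ; N = M + (M + r) in
              (+ 1 + (N + N)) + + 1
                ≡ (M + M' + (+ 1 + r)) * + 0 + (M * + 2 + (M * + 2 + ((+ 1 + r) * + 2 + + 0)))
      total = solve-∀

  -- m = 2M + 1 with M = a + b, n = 2(M + a + 1): weight 2m.  All rows sum to 2.
  module LowOddEven (a b : ℕ) where

    M : ℕ
    M = a ℕ.+ b

    blocks : List Block
    blocks = block (suc a) pos neg true ∷ block (suc a) neg pos true ∷ block a (diag 0) pos false
           ∷ block b (diag a) pos true ∷ block M pos (diag 0) false ∷ []

    open Layout M 1 blocks

    topSum : ∀ i → i ℕ.< M → topRow i ≡ + 2
    topSum i i<M with i ℕ.<? a
    ... | yes i<a = trans (plusses (suc a) ⟨+⟩ minuses (suc a) ⟨+⟩ diag-row 0 i a z≤n i<a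
                             ⟨+⟩ diag-row-below a i b i<a ⟨+⟩ plusses M ⟨+⟩ noMore)
                          (rowValue (+ a) (+ b))
      where rowValue : ∀ a b → (+ 1 + a) + (- (+ 1 + a) + ((+ 2 - a) + (- b + ((a + b) + + 0)))) ≡ + 2
            rowValue = solve-∀
    ... | no  i≮a = trans (plusses (suc a) ⟨+⟩ minuses (suc a) ⟨+⟩ diag-row-above 0 i a a≤i
                             ⟨+⟩ diag-row a i b a≤i i<M ⟨+⟩ plusses M ⟨+⟩ noMore)
                          (rowValue (+ a) (+ b))
      where a≤i = ℕP.≮⇒≥ i≮a
            rowValue : ∀ a b → (+ 1 + a) + (- (+ 1 + a) + (- a + ((+ 2 - b) + ((a + b) + + 0)))) ≡ + 2
            rowValue = solve-∀

    bounds : RowBounds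
    bounds = record
      { topLB = + 2 ; bottomLB = + 2 ; extraLB = + 2
      ; top≤ = λ i i<M → exactly (topSum i i<M)
      ; bottom≤ = λ i i<M → exactly (trans (minuses (suc a) ⟨+⟩ plusses (suc a) ⟨+⟩ plusses a ⟨+⟩ plusses b
                                              ⟨+⟩ diag-row 0 i M z≤n i<M ⟨+⟩ noMore)
                                           (bottomSum (+ a) (+ b)))
      ; extra≤ = λ _ → exactly (trans (plusses (suc a) ⟨+⟩ plusses (suc a) ⟨+⟩ minuses a ⟨+⟩ plusses b
                                         ⟨+⟩ minuses M ⟨+⟩ noMore)
                                      (extraRowSum (+ a) (+ b))) }
      where
      bottomSum : ∀ a b → - (+ 1 + a) + ((+ 1 + a) + (a + (b + ((+ 2 - (a + b)) + + 0)))) ≡ + 2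
      bottomSum = solve-∀
      extraRowSum : ∀ a b → (+ 1 + a) + ((+ 1 + a) + (- a + (b + (- (a + b) + + 0)))) ≡ + 2
      extraRowSum = solve-∀

    open Checked bounds

    checks : All CheckedBlock blocks
    checks = checked (+ 1) (λ k _ → upDownCol M 1 (suc a) true k) ≤! ≤! (λ _ → ≤!)
           ∷ checked (+ 1) (λ k _ → downUpCol M 1 (suc a) true k) ≤! ≤! (λ _ → ≤!)
           ∷ checked (+ 1) (λ k k<a → diagUpCol M 1 0 a false (ℕP.<-≤-trans k<a (ℕP.m≤m+n a b)))
                     ≤! ≤! (λ _ → ≤!)
           ∷ checked (+ 3) (λ k k<b → diagUpCol M 1 a b true (ℕP.+-monoʳ-< a k<b)) ≤! ≤! (λ _ → ≤!)
           ∷ checked (+ 1) (λ k k<M → upDiagCol M 1 M false k<M) ≤! ≤! (λ _ → ≤!)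
           ∷ []

    N : ℕ
    N = suc (M ℕ.+ a)

    sedf : HasSEDF (suc (M ℕ.+ M)) (N ℕ.+ N) (+ (2 ℕ.* suc (M ℕ.+ M)))
    sedf = HasSEDF-cast (rows M) (columns a b) (total (+ a) (+ b)) (design checks)
      where
      rows : ∀ M → suc (M ℕ.+ M) ≡ M ℕ.+ (M ℕ.+ 1)
      rows = ℕ-solve
      columns : ∀ a b → suc (a ℕ.+ b ℕ.+ a) ℕ.+ suc (a ℕ.+ b ℕ.+ a)
                        ≡ suc a ℕ.+ (suc a ℕ.+ (a ℕ.+ (b ℕ.+ ((a ℕ.+ b) ℕ.+ 0))))
      columns = ℕ-solve
      total : ∀ a b → let m = + 1 + ((a + b) + (a + b)) in
              m + (m + + 0) ≡ (+ 1 + a) * + 1 + ((+ 1 + a) * + 1 + (a * + 1 + (b * + 3 + ((a + b) * + 1 + + 0))))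
      total = solve-∀

  -- m = 2M + 1, n = 2(2M + 1 + c): weight n.  Rows sum to at least 2 and
  -- every column to 1.
  module MidOddEven (M c : ℕ) where

    blocks : List Block
    blocks = block (M ℕ.+ M ℕ.+ c) pos neg true ∷ block (suc (suc c)) neg pos true
           ∷ block M (diag 0) pos false ∷ block M (diag 0) pos false ∷ []

    open Layout M 1 blocks

    bounds : RowBounds
    bounds = record
      { topLB = + 2 ; bottomLB = + 2 ; extraLB = + 2
      ; top≤ = λ i i<M → exactly (trans (plusses (M ℕ.+ M ℕ.+ c) ⟨+⟩ minuses (suc (suc c))
                                           ⟨+⟩ diag-row 0 i M z≤n i<M ⟨+⟩ diag-row 0 i M z≤n i<M ⟨+⟩ noMore)
                                        (topSum (+ M) (+ c)))
      ; bottom≤ = λ i _ → exactly (trans (minuses (M ℕ.+ M ℕ.+ c) ⟨+⟩ plusses (suc (suc c)) ⟨+⟩ plusses M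
                                            ⟨+⟩ plusses M ⟨+⟩ noMore)
                                         (bottomSum (+ M) (+ c)))
      ; extra≤ = λ _ → ℤP.≤-trans (+≤+ (ℕP.m≤m+n 2 (c ℕ.+ c)))
                         (exactly (trans (plusses (M ℕ.+ M ℕ.+ c) ⟨+⟩ plusses (suc (suc c)) ⟨+⟩ minuses M
                                            ⟨+⟩ minuses M ⟨+⟩ noMore)
                                         (extraRowSum (+ M) (+ c)))) }
      where
      topSum : ∀ M c → (M + M + c) + (- (+ 2 + c) + ((+ 2 - M) + ((+ 2 - M) + + 0))) ≡ + 2
      topSum = solve-∀
      bottomSum : ∀ M c → - (M + M + c) + ((+ 2 + c) + (M + (M + + 0))) ≡ + 2
      bottomSum = solve-∀
      extraRowSum : ∀ M c → (M + M + c) + ((+ 2 + c) + (- M + (- M + + 0))) ≡ + 2 + (c + c)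
      extraRowSum = solve-∀

    open Checked bounds

    checks : All CheckedBlock blocks
    checks = checked (+ 1) (λ k _ → upDownCol M 1 (M ℕ.+ M ℕ.+ c) true k) ≤! ≤! (λ _ → ≤!)
           ∷ checked (+ 1) (λ k _ → downUpCol M 1 (suc (suc c)) true k) ≤! ≤! (λ _ → ≤!)
           ∷ checked (+ 1) (λ k k<M → diagUpCol M 1 0 M false k<M) ≤! ≤! (λ _ → ≤!)
           ∷ checked (+ 1) (λ k k<M → diagUpCol M 1 0 M false k<M) ≤! ≤! (λ _ → ≤!)
           ∷ []

    N : ℕ
    N = suc (M ℕ.+ (M ℕ.+ c))

    sedf : HasSEDF (suc (M ℕ.+ M)) (N ℕ.+ N) (+ (N ℕ.+ N))
    sedf = HasSEDF-cast (rows M) (columns M c) (total (+ M) (+ c)) (design checks)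
      where
      rows : ∀ M → suc (M ℕ.+ M) ≡ M ℕ.+ (M ℕ.+ 1)
      rows = ℕ-solve
      columns : ∀ M c → suc (M ℕ.+ (M ℕ.+ c)) ℕ.+ suc (M ℕ.+ (M ℕ.+ c))
                        ≡ (M ℕ.+ M ℕ.+ c) ℕ.+ (suc (suc c) ℕ.+ (M ℕ.+ (M ℕ.+ 0)))
      columns = ℕ-solve
      total : ∀ M c → let N = + 1 + (M + (M + c)) in
              N + N ≡ (M + M + c) * + 1 + ((+ 2 + c) * + 1 + (M * + 1 + (M * + 1 + + 0)))
      total = solve-∀

open CompleteBipartite

open import Data.Nat using (ℕ; suc; z≤n; s≤s; _≤_; _<_; _+_; _*_; _∸_; _⊓_; _⊔_; _≤?_; _<?_)
import Data.Nat.Properties as ℕP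
open import Data.Nat.Tactic.RingSolver using () renaming (solve-∀ to ℕ-solve)
open import Data.Integer as ℤ using (+_)
import Data.Integer.Properties as ℤP
open import Data.Product using (_×_; _,_; Σ-syntax)
open import Relation.Nullary using (yes; no)
open import Relation.Binary.PropositionalEquality

HasSEDF≤ : ℕ → ℕ → ℤ.ℤ → Set
HasSEDF≤ m n t = Σ[ f ∈ Labelling m n ] (IsSEDF f × weight f ℤ.≤ t)

atMost : ∀ {m n w T} → HasSEDF m n (+ w) → w ≤ T → HasSEDF≤ m n (+ T)
atMost (f , sedf , weight≡w) w≤T = f , sedf , subst (ℤ._≤ _) (sym weight≡w) (ℤ.+≤+ w≤T)

exactValue : ∀ {m n t} → HasSEDF≤ m n t → (∀ f → IsSEDF f → t ℤ.≤ weight f) →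
             SignedEdgeDominationNumber m n t
exactValue (f , sedf , weight≤t) lower = (f , sedf , ℤP.≤-antisym weight≤t (lower f sedf)) , lower

value-i value-ii value-iii value-iv : ℕ → ℕ → ℕ
value-i   m n = 2 * m ⊓ n
value-ii  m n = (2 * m ∸ 1) ⊓ n
value-iii m n = 3 * m ⊓ (2 * m ⊔ (n + 1))
value-iv  m n = (3 * m ∸ 1) ⊓ (2 * m ⊔ n)

≤-by : ∀ {a b} s → b ≡ a + s → a ≤ b
≤-by {a} s refl = ℕP.m≤m+n a s

twice : ∀ a → 2 * a ≡ a + a
twice a = cong (λ x → a + x) (ℕP.+-identityʳ a)

twice-mono : ∀ {a b} → a ≤ b → a + a ≤ b + b
twice-mono a≤b = ℕP.+-mono-≤ a≤b a≤b

odd-twice : ∀ x → 2 * suc x ∸ 1 ≡ suc (x + x)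
odd-twice x = trans (ℕP.+-suc x (x + 0)) (cong (λ y → suc (x + y)) (ℕP.+-identityʳ x))

odd-thrice : ∀ x → 3 * suc x ∸ 1 ≡ 2 + (x + (x + x))
odd-thrice x = reduced x
  where reduced : ∀ x → x + (suc x + (suc x + 0)) ≡ 2 + (x + (x + x))
        reduced = ℕ-solve

half-≤ : ∀ {M N} → M + M ≤ suc (N + N) → M ≤ N
half-≤ {M} {N} 2M≤2N+1 = ℕP.≮⇒≥ λ N<M →
  ℕP.<⇒≱ (ℕP.≤-trans (s≤s (ℕP.≤-reflexive (sym (ℕP.+-suc N N)))) (twice-mono N<M)) 2M≤2N+1

half-< : ∀ {M N} → suc (M + M) ≤ N + N → M < N
half-< {M} {N} 2M+1≤2N = ℕP.≮⇒≥ (λ N≤M → ℕP.<⇒≱ (s≤s (twice-mono (ℕP.≤-pred N≤M))) 2M+1≤2N)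

half-positive : ∀ {M} → 1 ≤ M + M → 1 ≤ M
half-positive {suc M} _ = s≤s z≤n

-- In each case n is split into ranges by naming the excess
-- parameters; each range is covered by one design, whose weight is then at
-- most the claimed value by an identity between the parameters.

upper-i-small : ∀ M t → t ≤ M → let N = M + t in HasSEDF≤ (M + M) (N + N) (+ value-i (M + M) (N + N))
upper-i-small M t t≤M =
  atMost (MidEven.sedf M t t≤M)
         (ℕP.⊓-glb (subst ((M + t) + (M + t) ≤_) (sym (twice (M + M))) (twice-mono (ℕP.+-monoʳ-≤ M t≤M)))
                   ℕP.≤-refl)

i-columns-large : ∀ M r → let N = M + suc (M + r) in N + N ≡ 0 + (2 + ((M + (M + r)) + (M + (M + r))))
i-columns-large = ℕ-solve

upper-i-large : ∀ M r → let N = M + suc (M + r) in HasSEDF≤ (M + M) (N + N) (+ value-i (M + M) (N + N))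
upper-i-large M r =
  atMost (HasSEDF-cast refl (i-columns-large M r) refl (Large.sedf M 0 2 (M + (M + r)) z≤n ℕP.≤-refl))
         (ℕP.⊓-glb ℕP.≤-refl (subst (_≤ N + N) (sym (twice (M + M))) (twice-mono M+M≤N)))
  where
  N = M + suc (M + r)
  M+M≤N : M + M ≤ N
  M+M≤N = ℕP.+-monoʳ-≤ M (ℕP.m≤n⇒m≤1+n (ℕP.m≤m+n M r))

upper-i : ∀ M N → M ≤ N → HasSEDF≤ (M + M) (N + N) (+ value-i (M + M) (N + N))
upper-i M N M≤N with excess M≤N
... | t , refl with t ≤? M
...   | yes t≤M = upper-i-small M t t≤M
...   | no  t≰M with excess (ℕP.≰⇒> t≰M)
...     | r , refl = upper-i-large M r

upper-ii-small : ∀ M t → t ≤ M → let N = M + t in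
                 HasSEDF≤ (suc (M + M)) (suc (N + N)) (+ value-ii (suc (M + M)) (suc (N + N)))
upper-ii-small M t t≤M =
  atMost (MidOdd.sedf M t t≤M)
         (ℕP.⊓-glb (subst (suc ((M + t) + (M + t)) ≤_) (sym (odd-twice (M + M)))
                          (s≤s (twice-mono (ℕP.+-monoʳ-≤ M t≤M))))
                   ℕP.≤-refl)

ii-columns-large : ∀ M r → let N = M + suc (M + r) in suc (N + N) ≡ 1 + (2 + ((M + (M + r)) + (M + (M + r))))
ii-columns-large = ℕ-solve

upper-ii-large : ∀ M r → let N = M + suc (M + r) in
                 HasSEDF≤ (suc (M + M)) (suc (N + N)) (+ value-ii (suc (M + M)) (suc (N + N)))
upper-ii-large M r =
  atMost (HasSEDF-cast refl (ii-columns-large M r) refl (Large.sedf M 1 2 (M + (M + r)) ℕP.≤-refl (s≤s (s≤s z≤n))))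
         (ℕP.⊓-glb ℕP.≤-refl (subst (_≤ suc (N + N)) (sym (odd-twice (M + M))) (s≤s (twice-mono M+M≤N))))
  where
  N = M + suc (M + r)
  M+M≤N : M + M ≤ N
  M+M≤N = ℕP.+-monoʳ-≤ M (ℕP.m≤n⇒m≤1+n (ℕP.m≤m+n M r))

upper-ii : ∀ M N → M ≤ N → HasSEDF≤ (suc (M + M)) (suc (N + N)) (+ value-ii (suc (M + M)) (suc (N + N)))
upper-ii M N M≤N with excess M≤N
... | t , refl with t ≤? M
...   | yes t≤M = upper-ii-small M t t≤M
...   | no  t≰M with excess (ℕP.≰⇒> t≰M)
...     | r , refl = upper-ii-large M r

upper-iii-low : ∀ M t → t < M → let N = M + t in
                HasSEDF≤ (M + M) (suc (N + N)) (+ value-iii (M + M) (suc (N + N)))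
upper-iii-low M t t<M with excess t<M
... | h , refl = atMost (LowEvenOdd.sedf t h)
                        (ℕP.⊓-glb (ℕP.*-monoˡ-≤ (M + M) {2} {3} (s≤s (s≤s z≤n)))
                                  (ℕP.m≤m⊔n (2 * (M + M)) (suc ((M + t) + (M + t)) + 1)))

iii-slack-mid : ∀ r d → let M = suc (r + d) ; N = M + (M + r) in
                3 * (M + M) ≡ (suc (N + N) + 1) + (d + d)
iii-slack-mid = ℕ-solve

upper-iii-mid : ∀ M r → r < M → let N = M + (M + r) in
                HasSEDF≤ (M + M) (suc (N + N)) (+ value-iii (M + M) (suc (N + N)))
upper-iii-mid M r r<M with excess r<M
... | d , refl = atMost (MidEvenOdd.sedf (r + d) r)
                        (ℕP.⊓-glb (≤-by (d + d) (iii-slack-mid r d)) (ℕP.m≤n⊔m (2 * (M + M)) _))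

iii-columns-large : ∀ M₀ s → let M = suc M₀ ; N = M + (M + (M + s)) in
                    suc (N + N) ≡ 0 + (3 + ((M₀ + (M + (M + s))) + (M₀ + (M + (M + s)))))
iii-columns-large = ℕ-solve

iii-slack-large : ∀ M₀ s → let M = suc M₀ ; N = M + (M + (M + s)) in
                  suc (N + N) + 1 ≡ 3 * (M + M) + (suc s + suc s)
iii-slack-large = ℕ-solve

upper-iii-high : ∀ M₀ r → suc M₀ ≤ r → let M = suc M₀ ; N = M + (M + r) in
                 HasSEDF≤ (M + M) (suc (N + N)) (+ value-iii (M + M) (suc (N + N)))
upper-iii-high M₀ r M≤r with excess M≤r
... | s , refl =
  atMost (HasSEDF-cast refl (iii-columns-large M₀ s) refl
                       (Large.sedf (suc M₀) 0 3 (M₀ + (suc M₀ + (suc M₀ + s))) z≤n (s≤s (s≤s z≤n))))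
         (ℕP.⊓-glb ℕP.≤-refl
                   (ℕP.m≤n⇒m≤o⊔n (2 * (suc M₀ + suc M₀)) (≤-by (suc s + suc s) (iii-slack-large M₀ s))))

upper-iii : ∀ M N → 1 ≤ M → M ≤ N → HasSEDF≤ (M + M) (suc (N + N)) (+ value-iii (M + M) (suc (N + N)))
upper-iii (suc M₀) N _ M≤N with excess M≤N
... | t , refl with t <? suc M₀
...   | yes t<M = upper-iii-low (suc M₀) t t<M
...   | no  t≮M with excess (ℕP.≮⇒≥ t≮M)
...     | r , refl with r <? suc M₀
...       | yes r<M = upper-iii-mid (suc M₀) r r<M
...       | no  r≮M = upper-iii-high M₀ r (ℕP.≮⇒≥ r≮M)

iv-slack-low : ∀ x → 2 + (x + (x + x)) ≡ 2 * suc x + x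
iv-slack-low = ℕ-solve

upper-iv-low : ∀ M t → t ≤ M → let N = suc (M + t) in
               HasSEDF≤ (suc (M + M)) (N + N) (+ value-iv (suc (M + M)) (N + N))
upper-iv-low M t t≤M with excess t≤M
... | b , refl = atMost (LowOddEven.sedf t b)
                        (ℕP.⊓-glb (subst (2 * suc (M + M) ≤_) (sym (odd-thrice (M + M)))
                                         (≤-by (M + M) (iv-slack-low (M + M))))
                                  (ℕP.m≤m⊔n (2 * suc (M + M)) (suc (M + t) + suc (M + t))))

iv-slack-mid : ∀ c d → let M = c + d ; N = suc (M + (M + c)) in
               2 + ((M + M) + ((M + M) + (M + M))) ≡ (N + N) + (d + d)
iv-slack-mid = ℕ-solve

upper-iv-mid : ∀ M c → c ≤ M → let N = suc (M + (M + c)) in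
               HasSEDF≤ (suc (M + M)) (N + N) (+ value-iv (suc (M + M)) (N + N))
upper-iv-mid M c c≤M with excess c≤M
... | d , refl = atMost (MidOddEven.sedf (c + d) c)
                        (ℕP.⊓-glb (subst (N + N ≤_) (sym (odd-thrice (M + M))) (≤-by (d + d) (iv-slack-mid c d)))
                                  (ℕP.m≤n⊔m (2 * suc (M + M)) (N + N)))
  where N = MidOddEven.N M c

iv-columns-large : ∀ M s → let N = suc (M + (M + suc (M + s))) in
                   N + N ≡ 1 + (3 + ((M + (M + (M + s))) + (M + (M + (M + s)))))
iv-columns-large = ℕ-solve

iv-slack-large : ∀ M s → let N = suc (M + (M + suc (M + s))) in
                 N + N ≡ 2 + ((M + M) + ((M + M) + (M + M))) + (suc s + suc s)
iv-slack-large = ℕ-solve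

upper-iv-high : ∀ M c → M < c → let N = suc (M + (M + c)) in
                HasSEDF≤ (suc (M + M)) (N + N) (+ value-iv (suc (M + M)) (N + N))
upper-iv-high M c M<c with excess M<c
... | s , refl =
  atMost (HasSEDF-cast refl (iv-columns-large M s) refl
                       (Large.sedf M 1 3 (M + (M + (M + s))) (s≤s z≤n) (s≤s (s≤s z≤n))))
         (ℕP.⊓-glb ℕP.≤-refl
                   (ℕP.m≤n⇒m≤o⊔n (2 * suc (M + M))
                                 (subst (_≤ N + N) (sym (odd-thrice (M + M))) (≤-by (suc s + suc s) (iv-slack-large M s)))))
  where N = MidOddEven.N M (suc (M + s))

upper-iv : ∀ M N → M < N → HasSEDF≤ (suc (M + M)) (N + N) (+ value-iv (suc (M + M)) (N + N))
upper-iv M N M<N with excess M<N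
... | t , refl with M ≤? t
...   | no  M≰t = upper-iv-low M t (ℕP.<⇒≤ (ℕP.≰⇒> M≰t))
...   | yes M≤t with excess M≤t
...     | c , refl with c ≤? M
...       | yes c≤M = upper-iv-mid M c c≤M
...       | no  c≰M = upper-iv-high M c (ℕP.≰⇒> c≰M)

part-i : ∀ m n → 1 ≤ m → m ≤ n → Even m → Even n → SignedEdgeDominationNumber m n (+ value-i m n)
part-i m n 1≤m m≤n evenM evenN with even-half evenM | even-half evenN
... | M , refl | N , refl = exactValue (upper-i M N (half-≤ (ℕP.m≤n⇒m≤1+n m≤n)))
                                       (λ f sedf → CaseBounds.bound-i f sedf 1≤m m≤n evenN)

part-ii : ∀ m n → 1 ≤ m → m ≤ n → Odd m → Odd n → SignedEdgeDominationNumber m n (+ value-ii m n)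
part-ii m n 1≤m m≤n oddM oddN with odd-half oddM | odd-half oddN
... | M , refl | N , refl = exactValue (upper-ii M N (half-≤ (ℕP.m≤n⇒m≤1+n (ℕP.≤-pred m≤n))))
                                       (λ f sedf → CaseBounds.bound-ii f sedf 1≤m m≤n oddM)

part-iii : ∀ m n → 1 ≤ m → m ≤ n → Even m → Odd n → SignedEdgeDominationNumber m n (+ value-iii m n)
part-iii m n 1≤m m≤n evenM oddN with even-half evenM | odd-half oddN
... | M , refl | N , refl = exactValue (upper-iii M N (half-positive 1≤m) (half-≤ m≤n))
                                       (λ f sedf → CaseBounds.bound-iii f sedf 1≤m m≤n evenM oddN)

part-iv : ∀ m n → 1 ≤ m → m ≤ n → Odd m → Even n → SignedEdgeDominationNumber m n (+ value-iv m n)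
part-iv m n 1≤m m≤n oddM evenN with odd-half oddM | even-half evenN
... | M , refl | N , refl = exactValue (upper-iv M N (half-< m≤n))
                                       (λ f sedf → CaseBounds.bound-iv f sedf 1≤m m≤n oddM evenN)

mainTheorem3 : (m n : ℕ) → 1 ≤ m → m ≤ n →
    (Even m → Even n → SignedEdgeDominationNumber m n (+ ((2 * m) ⊓ n)))
    × (Odd m → Odd n → SignedEdgeDominationNumber m n (+ ((2 * m ∸ 1) ⊓ n)))
    × (Even m → Odd n → SignedEdgeDominationNumber m n (+ ((3 * m) ⊓ ((2 * m) ⊔ (n + 1)))))
    × (Odd m → Even n → SignedEdgeDominationNumber m n (+ ((3 * m ∸ 1) ⊓ ((2 * m) ⊔ n))))
mainTheorem3 m n 1≤m m≤n =
  part-i m n 1≤m m≤n , part-ii m n 1≤m m≤n , part-iii m n 1≤m m≤n , part-iv m n 1≤m m≤n
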